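{- Fix $\ell\ge1$ and let $P(t,x,y)=\sum_G t^{p_\ell(G)}x^{\#H(G)}y^{\#U(G)}$, the sum over all bargraphs $G$. Then $$xP^2-\bigl(1-x-y-xy-(1-t)x^{\ell+1}y\bigr)P+y\bigl(x-(1-t)(1-x)x^{\ell}\bigr)=0,$$ and $$P(t,z,z)=\frac{1-2z-z^2+(t-1)z^{\ell+2}-\sqrt{1-4z+2z^2+z^4+2(1-t)z^{\ell+2}(1+z^2)+(1-t)^2z^{2\ell+4}}}{2z}.$$
   Context: A bargraph is a lattice path with steps $U=(0,1)$, $H=(1,0)$, $D=(0,-1)$, identified with its word over $\{U,H,D\}$, that starts at the origin, ends on the $x$-axis, stays strictly above the $x$-axis except at its endpoints, and contains no two consecutive steps $UD$ or $DU$ (the empty path is not a bargraph). $\#H(G)$, $\#U(G)$ denote the numbers of $H$ and $U$ steps. A peak of width $\ell$ is an occurrence of the consecutive factor $UH^\ell D$, and $p_\ell(G)$ is the number of peaks of width $\ell$ in $G$. -}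

module Defs where

open import Data.Nat using (ℕ; zero; suc; _+_; _*_; _∸_; _≡ᵇ_)
open import Data.Bool using (Bool; true; false; _∧_; if_then_else_) renaming (_≟_ to _≟ᵇ_)
open import Data.List using (List; []; _∷_; replicate; _++_; map; concatMap; upTo; length; filter)
open import Data.Maybe using (Maybe; just; nothing)
open import Data.Integer using (ℤ; +_; -_) renaming (_+_ to _+ℤ_; _*_ to _*ℤ_)
open import Relation.Nullary.Decidable using (does)

data Step : Set where
  U H D : Step

-- height after one step from height h (nothing = would go below axis,
-- or an H step on the x-axis, which is not strictly above the axis)
step : Step → ℕ → Maybe ℕ
step U h       = just (suc h)
step H zero    = nothing
step H (suc h) = just (suc h)
step D zero    = nothing
step D (suc h) = just h

isZero isPos : ℕ → Bool
isZero zero    = true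
isZero (suc _) = false
isPos zero     = false
isPos (suc _)  = true

-- run h w : the nonempty word w, started at height h, stays strictly
-- above the x-axis at every intermediate point and ends on the x-axis.
mutual
  run : ℕ → List Step → Bool
  run h []      = false
  run h (s ∷ w) with step s h
  ... | nothing = false
  ... | just h' = continue h' w

  continue : ℕ → List Step → Bool
  continue h' []      = isZero h'
  continue h' (s ∷ w) = isPos h' ∧ run h' (s ∷ w)

noUDDU : List Step → Bool
noUDDU (U ∷ D ∷ w) = false
noUDDU (D ∷ U ∷ w) = false
noUDDU (s ∷ w)     = noUDDU w
noUDDU []          = true

isBargraph : List Step → Bool
isBargraph w = run 0 w ∧ noUDDU w

eqStep : Step → Step → Bool
eqStep U U = true
eqStep H H = true
eqStep D D = true
eqStep _ _ = false

count : Step → List Step → ℕ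
count s []      = 0
count s (s' ∷ w) = (if eqStep s s' then 1 else 0) + count s w

#H #U : List Step → ℕ
#H = count H
#U = count U

isPrefix : List Step → List Step → Bool
isPrefix []      w       = true
isPrefix (p ∷ q) []      = false
isPrefix (p ∷ q) (s ∷ w) = eqStep p s ∧ isPrefix q w

occurrences : List Step → List Step → ℕ
occurrences pat []      = if isPrefix pat [] then 1 else 0
occurrences pat (s ∷ w) = (if isPrefix pat (s ∷ w) then 1 else 0) + occurrences pat w

peaks : ℕ → List Step → ℕ
peaks ℓ = occurrences (U ∷ replicate ℓ H ++ D ∷ [])

words : ℕ → List (List Step)
words zero    = [] ∷ []
words (suc n) = concatMap (λ w → (U ∷ w) ∷ (H ∷ w) ∷ (D ∷ w) ∷ []) (words n)

PS3 : Set
PS3 = ℕ → ℕ → ℕ → ℤ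

PS2 : Set
PS2 = ℕ → ℕ → ℤ

sumTo : ℕ → (ℕ → ℤ) → ℤ
sumTo zero    f = f 0
sumTo (suc n) f = sumTo n f +ℤ f (suc n)

infixl 6 _⊕_ _⊖_ _⊕₂_ _⊖₂_
infixl 7 _⊗_ _⊗₂_

_⊕_ _⊖_ _⊗_ : PS3 → PS3 → PS3
(f ⊕ g) i j k = f i j k +ℤ g i j k
(f ⊖ g) i j k = f i j k +ℤ (- g i j k)
(f ⊗ g) i j k = sumTo i λ a → sumTo j λ b → sumTo k λ c →
                  f a b c *ℤ g (i ∸ a) (j ∸ b) (k ∸ c)

mono : ℕ → ℕ → ℕ → PS3
mono a b c i j k = if (a ≡ᵇ i) ∧ (b ≡ᵇ j) ∧ (c ≡ᵇ k) then + 1 else + 0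

_⊕₂_ _⊖₂_ _⊗₂_ : PS2 → PS2 → PS2
(f ⊕₂ g) i n = f i n +ℤ g i n
(f ⊖₂ g) i n = f i n +ℤ (- g i n)
(f ⊗₂ g) i n = sumTo i λ a → sumTo n λ b → f a b *ℤ g (i ∸ a) (n ∸ b)

mono₂ : ℕ → ℕ → PS2
mono₂ a b i n = if (a ≡ᵇ i) ∧ (b ≡ᵇ n) then + 1 else + 0

-- Coefficient of t^i x^j y^k = number of bargraphs G with p_ℓ(G)=i,
-- #H(G)=j, #U(G)=k.  Such a G has #D(G)=#U(G) (it ends on the x-axis),
-- hence has length j+2k, so it suffices to enumerate words of length j+2k.

selected : ℕ → ℕ → ℕ → ℕ → List Step → Bool
selected ℓ i j k w =
  isBargraph w ∧ (peaks ℓ w ≡ᵇ i) ∧ (#H w ≡ᵇ j) ∧ (#U w ≡ᵇ k)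

P : ℕ → PS3
P ℓ i j k = + length (filter (λ w → selected ℓ i j k w ≟ᵇ true) (words (j + 2 * k)))

-- P(t,z,z): coefficient of t^i z^n is Σ_{j=0}^{n} [t^i x^j y^(n-j)] P
Pzz : ℕ → PS2
Pzz ℓ i n = sumTo n λ j → P ℓ i j (n ∸ j)

term : ℤ → ℕ → ℕ → ℕ → PS3
term c a b d i j k = c *ℤ mono a b d i j k

term₂ : ℤ → ℕ → ℕ → PS2
term₂ c a b i n = c *ℤ mono₂ a b i n

module Submission where

-- A bargraph is U s D where the interior s is a nonempty walk that returns to its starting height without
-- going below it; the peaks of U s D are those of s D, plus one when s = H^ℓ. An interior starts either
-- with H, followed by nothing or by an interior, or with a bargraph (up to its first return), followed by
-- nothing or by H and then nothing or an interior. Summing monomial weights over words, with S the series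
-- of interiors, this reads P = yS + (t - 1)x^ℓy and S = x(1 + S) + P(1 + x(1 + S)), and the functional
-- equation is a consequence in the commutative ring of power series. The substitution x = y = z is a ring
-- homomorphism, and completing the square in the resulting quadratic equation for P(t,z,z) gives the
-- discriminant.

open import Algebra.Bundles using (CommutativeRing)
open import Algebra.Core using (Op₂)
open import Algebra.Morphism.Structures using (module RingMorphisms)
import Algebra.Solver.Ring.AlmostCommutativeRing as ACR
open import Data.Bool using (Bool; true; false; _∧_; if_then_else_; T) renaming (_≟_ to _≟ᵇ_)
open import Data.Bool.Properties using (∧-identityʳ)
open import Data.Empty using (⊥-elim)
open import Data.Integer as ℤ using (ℤ; +_; -[1+_]; _◃_; ∣_∣; sign)
import Data.Integer.Properties as ℤ
open import Data.List using (List; []; _∷_; _++_; [_]; length; replicate; filter; foldr; concatMap; initLast; _∷ʳ′_)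
import Data.List.Properties as List
open import Data.Maybe using (Maybe; just; nothing; _>>=_)
open import Data.Nat as ℕ using (ℕ; zero; suc; _∸_; _≤_; _<_; z≤n; s≤s)
import Data.Nat.Properties as ℕ
open import Data.Product using (Σ; _,_; ∃; ∃₂)
open import Data.Sign as Sign using (Sign)
open import Data.Unit using (tt)
open import Function using (_∘_)
open import Level using (0ℓ)
open import Relation.Binary.Definitions using (DecidableEquality)
open import Relation.Binary.PropositionalEquality as ≡ using (_≡_; _≢_)
open import Relation.Nullary using (Dec; yes; no)
import Defs

-- Finite sums and power series over a commutative ring

module FiniteSums {c ℓ} (R : CommutativeRing c ℓ) where

  open CommutativeRing R
  open import Algebra.Properties.CommutativeSemigroup +-commutativeSemigroup using (interchange)
  open import Relation.Binary.Reasoning.Setoid setoid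

  ∑ : ℕ → (ℕ → Carrier) → Carrier
  ∑ zero    f = f 0
  ∑ (suc n) f = ∑ n f + f (suc n)

  ∑-cong : ∀ n {f g} → (∀ a → a ≤ n → f a ≈ g a) → ∑ n f ≈ ∑ n g
  ∑-cong zero    f≈g = f≈g 0 z≤n
  ∑-cong (suc n) f≈g = +-cong (∑-cong n (λ a a≤n → f≈g a (ℕ.m≤n⇒m≤1+n a≤n))) (f≈g (suc n) ℕ.≤-refl)

  ∑-congˡ : ∀ n {f g} → (∀ a → f a ≈ g a) → ∑ n f ≈ ∑ n g
  ∑-congˡ n f≈g = ∑-cong n (λ a _ → f≈g a)

  ∑-zero : ∀ n {f} → (∀ a → a ≤ n → f a ≈ 0#) → ∑ n f ≈ 0#
  ∑-zero zero    f≈0 = f≈0 0 z≤n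
  ∑-zero (suc n) f≈0 = begin
    ∑ n _ + _  ≈⟨ +-cong (∑-zero n (λ a a≤n → f≈0 a (ℕ.m≤n⇒m≤1+n a≤n))) (f≈0 (suc n) ℕ.≤-refl) ⟩
    0# + 0#    ≈⟨ +-identityˡ 0# ⟩
    0#         ∎

  ∑-+ : ∀ n (f g : ℕ → Carrier) → ∑ n (λ a → f a + g a) ≈ ∑ n f + ∑ n g
  ∑-+ zero    f g = refl
  ∑-+ (suc n) f g = trans (+-congʳ (∑-+ n f g)) (interchange _ _ _ _)

  *-∑ : ∀ n x (f : ℕ → Carrier) → x * ∑ n f ≈ ∑ n (λ a → x * f a)
  *-∑ zero    x f = refl
  *-∑ (suc n) x f = trans (distribˡ x _ _) (+-congʳ (*-∑ n x f))

  ∑-* : ∀ n x (f : ℕ → Carrier) → ∑ n f * x ≈ ∑ n (λ a → f a * x)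
  ∑-* zero    x f = refl
  ∑-* (suc n) x f = trans (distribʳ x _ _) (+-congʳ (∑-* n x f))

  ∑-suc : ∀ n (f : ℕ → Carrier) → ∑ (suc n) f ≈ f 0 + ∑ n (f ∘ suc)
  ∑-suc zero    f = refl
  ∑-suc (suc n) f = trans (+-congʳ (∑-suc n f)) (+-assoc _ _ _)

  ∑-reverse : ∀ n (f : ℕ → Carrier) → ∑ n f ≈ ∑ n (λ a → f (n ∸ a))
  ∑-reverse zero    f = refl
  ∑-reverse (suc n) f = begin
    ∑ n f + f (suc n)                 ≈⟨ +-comm _ _ ⟩
    f (suc n) + ∑ n f                 ≈⟨ +-congˡ (∑-reverse n f) ⟩
    f (suc n) + ∑ n (λ a → f (n ∸ a)) ≈⟨ sym (∑-suc n (λ a → f (suc n ∸ a))) ⟩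
    ∑ (suc n) (λ a → f (suc n ∸ a))   ∎

  ∑-single : ∀ n a {f} → a ≤ n → (∀ b → b ≤ n → b ≢ a → f b ≈ 0#) → ∑ n f ≈ f a
  ∑-single zero    zero    _   _   = refl
  ∑-single (suc n) a {f} a≤1+n f≈0 with a ℕ.≟ suc n
  ... | yes ≡.refl = trans (+-congʳ (∑-zero n (λ b b≤n → f≈0 b (ℕ.m≤n⇒m≤1+n b≤n) (ℕ.<⇒≢ (s≤s b≤n)))))
                           (+-identityˡ _)
  ... | no a≢1+n   = trans (+-congˡ (f≈0 (suc n) ℕ.≤-refl (a≢1+n ∘ ≡.sym)))
                           (trans (+-identityʳ _)
                           (∑-single n a (ℕ.≤-pred (ℕ.≤∧≢⇒< a≤1+n a≢1+n))
                                     (λ b b≤n → f≈0 b (ℕ.m≤n⇒m≤1+n b≤n))))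

  ∑-triangle : ∀ n (ψ : ℕ → ℕ → Carrier) → ∑ n (λ m → ∑ m (λ a → ψ a m)) ≈ ∑ n (λ a → ∑ (n ∸ a) (λ b → ψ a (a ℕ.+ b)))
  ∑-triangle zero    ψ = refl
  ∑-triangle (suc n) ψ = begin
    ∑ n (λ m → ∑ m (λ a → ψ a m)) + ∑ (suc n) (λ a → ψ a (suc n))
      ≈⟨ +-congʳ (∑-triangle n ψ) ⟩
    ∑ n inner + (∑ n (λ a → ψ a (suc n)) + ψ (suc n) (suc n))
      ≈⟨ sym (+-assoc _ _ _) ⟩
    (∑ n inner + ∑ n (λ a → ψ a (suc n))) + ψ (suc n) (suc n)
      ≈⟨ +-cong (sym (∑-+ n inner (λ a → ψ a (suc n)))) last ⟩
    ∑ n (λ a → inner a + ψ a (suc n)) + ∑ (suc n ∸ suc n) (λ b → ψ (suc n) (suc n ℕ.+ b))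
      ≈⟨ +-congʳ (∑-cong n (λ a a≤n → sym (step a a≤n))) ⟩
    ∑ (suc n) (λ a → ∑ (suc n ∸ a) (λ b → ψ a (a ℕ.+ b)))
      ∎
    where
    inner : ℕ → Carrier
    inner a = ∑ (n ∸ a) (λ b → ψ a (a ℕ.+ b))
    last : ψ (suc n) (suc n) ≈ ∑ (n ∸ n) (λ b → ψ (suc n) (suc n ℕ.+ b))
    last rewrite ℕ.n∸n≡0 n | ℕ.+-identityʳ n = refl
    step : ∀ a → a ≤ n → ∑ (suc n ∸ a) (λ b → ψ a (a ℕ.+ b)) ≈ inner a + ψ a (suc n)
    step a a≤n rewrite ℕ.+-∸-assoc 1 a≤n =
      +-congˡ (reflexive (≡.cong (ψ a) (≡.trans (ℕ.+-suc a (n ∸ a)) (≡.cong suc (ℕ.m+[n∸m]≡n a≤n)))))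

  ∑-swap : ∀ n (χ : ℕ → ℕ → Carrier) → ∑ n (λ b → ∑ (n ∸ b) (χ b)) ≈ ∑ n (λ c → ∑ (n ∸ c) (λ b → χ b c))
  ∑-swap n χ = begin
    ∑ n (λ b → ∑ (n ∸ b) (χ b))
      ≈⟨ ∑-congˡ n (λ b → ∑-congˡ (n ∸ b) (λ d → reflexive (≡.cong (χ b) (≡.sym (ℕ.m+n∸m≡n b d))))) ⟩
    ∑ n (λ b → ∑ (n ∸ b) (λ d → χ b (b ℕ.+ d ∸ b)))
      ≈⟨ sym (∑-triangle n (λ b m → χ b (m ∸ b))) ⟩
    ∑ n (λ m → ∑ m (λ b → χ b (m ∸ b)))
      ≈⟨ ∑-congˡ n (λ m → trans (∑-reverse m _) (∑-cong m (λ c c≤m → reflexive (≡.cong (χ (m ∸ c)) (ℕ.m∸[m∸n]≡n c≤m))))) ⟩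
    ∑ n (λ m → ∑ m (λ c → χ (m ∸ c) c))
      ≈⟨ ∑-triangle n (λ c m → χ (m ∸ c) c) ⟩
    ∑ n (λ c → ∑ (n ∸ c) (λ d → χ (c ℕ.+ d ∸ c) c))
      ≈⟨ ∑-congˡ n (λ c → ∑-congˡ (n ∸ c) (λ d → reflexive (≡.cong (λ b → χ b c) (ℕ.m+n∸m≡n c d)))) ⟩
    ∑ n (λ c → ∑ (n ∸ c) (λ b → χ b c))
      ∎

  ∑-neg : ∀ n (f : ℕ → Carrier) → ∑ n (λ a → - f a) ≈ - ∑ n f
  ∑-neg zero    f = refl
  ∑-neg (suc n) f = trans (+-congʳ (∑-neg n f)) (⁻¹-∙-comm _ _)
    where open import Algebra.Properties.AbelianGroup +-abelianGroup using (⁻¹-∙-comm)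

  ∑-comm : ∀ m n (h : ℕ → ℕ → Carrier) → ∑ m (λ a → ∑ n (h a)) ≈ ∑ n (λ b → ∑ m (λ a → h a b))
  ∑-comm zero    n h = refl
  ∑-comm (suc m) n h = trans (+-congʳ (∑-comm m n h)) (sym (∑-+ n _ _))

-- `Tactic.RingSolver` cannot normalise the constants of an abstract ring, so the identities below go
-- through `Algebra.Solver.Ring` with integer coefficients, interpreted as the multiples n × 1#.
module IntegerCoefficients {c ℓ} (R : CommutativeRing c ℓ) where

  open CommutativeRing R
  open import Algebra.Properties.Semiring.Mult.TCOptimised semiring using (_×_; 1+×; ×-homo-+; ×1-homo-*)
  open import Algebra.Properties.Ring ring using (-‿distribˡ-*; -‿distribʳ-*; -0#≈0#; -‿involutive; -‿+-comm)
  open import Algebra.Properties.CommutativeSemigroup +-commutativeSemigroup using (interchange)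
  open import Relation.Binary.Reasoning.Setoid setoid

  private
    signed : Sign → Carrier → Carrier
    signed Sign.+ x = x
    signed Sign.- x = - x

    ⟦_⟧ : ℤ → Carrier
    ⟦ + n      ⟧ = n × 1#
    ⟦ -[1+ n ] ⟧ = - (suc n × 1#)

    signed-cong : ∀ s {x y} → x ≈ y → signed s x ≈ signed s y
    signed-cong Sign.+ x≈y = x≈y
    signed-cong Sign.- x≈y = -‿cong x≈y

    signed-* : ∀ s t x y → signed (s Sign.* t) (x * y) ≈ signed s x * signed t y
    signed-* Sign.+ Sign.+ x y = refl
    signed-* Sign.+ Sign.- x y = -‿distribʳ-* x y
    signed-* Sign.- Sign.+ x y = -‿distribˡ-* x y
    signed-* Sign.- Sign.- x y = begin
      x * y         ≈⟨ -‿involutive (x * y) ⟨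
      - - (x * y)   ≈⟨ -‿cong (-‿distribʳ-* x y) ⟩
      - (x * - y)   ≈⟨ -‿distribˡ-* x (- y) ⟩
      - x * - y     ∎

    ⟦◃⟧ : ∀ s n → ⟦ s ◃ n ⟧ ≈ signed s (n × 1#)
    ⟦◃⟧ Sign.+ zero    = refl
    ⟦◃⟧ Sign.- zero    = sym -0#≈0#
    ⟦◃⟧ Sign.+ (suc n) = refl
    ⟦◃⟧ Sign.- (suc n) = refl

    ⟦⟧-signed : ∀ i → ⟦ i ⟧ ≈ signed (sign i) (∣ i ∣ × 1#)
    ⟦⟧-signed (+ n)      = refl
    ⟦⟧-signed -[1+ n ]   = refl

    ⟦⊖⟧ : ∀ m n → ⟦ m ℤ.⊖ n ⟧ ≈ m × 1# - n × 1#
    ⟦⊖⟧ zero    zero    = sym (trans (+-congˡ -0#≈0#) (+-identityʳ 0#))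
    ⟦⊖⟧ zero    (suc n) = sym (+-identityˡ _)
    ⟦⊖⟧ (suc m) zero    = sym (trans (+-congˡ -0#≈0#) (+-identityʳ _))
    ⟦⊖⟧ (suc m) (suc n) = begin
      ⟦ suc m ℤ.⊖ suc n ⟧                   ≡⟨ ≡.cong ⟦_⟧ (ℤ.[1+m]⊖[1+n]≡m⊖n m n) ⟩
      ⟦ m ℤ.⊖ n ⟧                           ≈⟨ ⟦⊖⟧ m n ⟩
      a - b                               ≈⟨ +-identityˡ (a - b) ⟨
      0# + (a - b)                        ≈⟨ +-congʳ (-‿inverseʳ 1#) ⟨
      (1# - 1#) + (a - b)                 ≈⟨ interchange 1# (- 1#) a (- b) ⟩
      (1# + a) + (- 1# + - b)             ≈⟨ +-cong (1+× m 1#) (sym (-‿+-comm 1# b)) ⟨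
      suc m × 1# - (1# + b)               ≈⟨ +-congˡ (-‿cong (1+× n 1#)) ⟨
      suc m × 1# - suc n × 1#             ∎
      where
      a = m × 1#
      b = n × 1#

    +-homo : ∀ i j → ⟦ i ℤ.+ j ⟧ ≈ ⟦ i ⟧ + ⟦ j ⟧
    +-homo (+ m)      (+ n)      = ×-homo-+ 1# m n
    +-homo (+ m)      -[1+ n ]   = ⟦⊖⟧ m (suc n)
    +-homo -[1+ m ]   (+ n)      = trans (⟦⊖⟧ n (suc m)) (+-comm _ _)
    +-homo -[1+ m ]   -[1+ n ]   = begin
      - (suc (suc (m ℕ.+ n)) × 1#)        ≡⟨ ≡.cong (λ k → - (k × 1#)) (ℕ.+-suc (suc m) n) ⟨
      - ((suc m ℕ.+ suc n) × 1#)          ≈⟨ -‿cong (×-homo-+ 1# (suc m) (suc n)) ⟩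
      - (suc m × 1# + suc n × 1#)         ≈⟨ -‿+-comm _ _ ⟨
      - (suc m × 1#) + - (suc n × 1#)     ∎

    *-homo : ∀ i j → ⟦ i ℤ.* j ⟧ ≈ ⟦ i ⟧ * ⟦ j ⟧
    *-homo i j = begin
      ⟦ sign i Sign.* sign j ◃ ∣ i ∣ ℕ.* ∣ j ∣ ⟧                      ≈⟨ ⟦◃⟧ (sign i Sign.* sign j) (∣ i ∣ ℕ.* ∣ j ∣) ⟩
      signed (sign i Sign.* sign j) ((∣ i ∣ ℕ.* ∣ j ∣) × 1#)          ≈⟨ signed-cong (sign i Sign.* sign j) (×1-homo-* ∣ i ∣ ∣ j ∣) ⟩
      signed (sign i Sign.* sign j) (∣ i ∣ × 1# * ∣ j ∣ × 1#)         ≈⟨ signed-* (sign i) (sign j) _ _ ⟩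
      signed (sign i) (∣ i ∣ × 1#) * signed (sign j) (∣ j ∣ × 1#)    ≈⟨ *-cong (⟦⟧-signed i) (⟦⟧-signed j) ⟨
      ⟦ i ⟧ * ⟦ j ⟧                                                   ∎

    -‿homo : ∀ i → ⟦ ℤ.- i ⟧ ≈ - ⟦ i ⟧
    -‿homo (+ zero)  = sym -0#≈0#
    -‿homo (+ suc n) = refl
    -‿homo -[1+ n ]  = sym (-‿involutive _)

    integerMultiples : ACR._-Raw-AlmostCommutative⟶_ (CommutativeRing.rawRing ℤ.+-*-commutativeRing) (ACR.fromCommutativeRing R)
    integerMultiples = record
      { ⟦_⟧ = ⟦_⟧ ; +-homo = +-homo ; *-homo = *-homo ; -‿homo = -‿homo ; 0-homo = refl ; 1-homo = refl }

    coefficientEquality : ∀ i j → Maybe (⟦ i ⟧ ≈ ⟦ j ⟧)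
    coefficientEquality i j with i ℤ.≟ j
    ... | yes ≡.refl = just refl
    ... | no _       = nothing

  open import Algebra.Solver.Ring _ _ integerMultiples coefficientEquality public
    using (Polynomial; solve; _:=_; _:+_; _:*_; _:-_; con)


module PowerSeries {c ℓ} (R : CommutativeRing c ℓ) where

  open CommutativeRing R
  open FiniteSums R
  open import Relation.Binary.Reasoning.Setoid setoid

  Series : Set c
  Series = ℕ → Carrier

  infix 4 _≋_
  _≋_ : Series → Series → Set ℓ
  f ≋ g = ∀ n → f n ≈ g n

  infixl 6 _⊞_
  infixl 7 _⊠_
  _⊞_ _⊠_ : Series → Series → Series
  (f ⊞ g) n = f n + g n
  (f ⊠ g) n = ∑ n (λ a → f a * g (n ∸ a))

  ⊟_ : Series → Series
  (⊟ f) n = - f n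

  𝟘 𝟙 : Series
  𝟘 n = 0#
  𝟙 zero    = 1#
  𝟙 (suc n) = 0#

  ⊠-cong : ∀ {f f′ g g′} → f ≋ f′ → g ≋ g′ → f ⊠ g ≋ f′ ⊠ g′
  ⊠-cong f≋f′ g≋g′ n = ∑-congˡ n (λ a → *-cong (f≋f′ a) (g≋g′ (n ∸ a)))

  ⊠-comm : ∀ f g → f ⊠ g ≋ g ⊠ f
  ⊠-comm f g n = begin
    ∑ n (λ a → f a * g (n ∸ a))             ≈⟨ ∑-reverse n _ ⟩
    ∑ n (λ a → f (n ∸ a) * g (n ∸ (n ∸ a))) ≈⟨ ∑-cong n (λ a a≤n →
                                                 trans (*-comm _ _) (*-congʳ (reflexive (≡.cong g (ℕ.m∸[m∸n]≡n a≤n))))) ⟩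
    ∑ n (λ a → g a * f (n ∸ a))             ∎

  ⊠-assoc : ∀ f g h → (f ⊠ g) ⊠ h ≋ f ⊠ (g ⊠ h)
  ⊠-assoc f g h n = begin
    ∑ n (λ m → ∑ m (λ a → f a * g (m ∸ a)) * h (n ∸ m))
      ≈⟨ ∑-congˡ n (λ m → ∑-* m _ _) ⟩
    ∑ n (λ m → ∑ m (λ a → f a * g (m ∸ a) * h (n ∸ m)))
      ≈⟨ ∑-triangle n _ ⟩
    ∑ n (λ a → ∑ (n ∸ a) (λ b → f a * g (a ℕ.+ b ∸ a) * h (n ∸ (a ℕ.+ b))))
      ≈⟨ ∑-congˡ n (λ a → ∑-congˡ (n ∸ a) (λ b → trans (*-assoc _ _ _)
           (*-congˡ (reflexive (≡.cong₂ (λ i j → g i * h j) (ℕ.m+n∸m≡n a b) (≡.sym (ℕ.∸-+-assoc n a b))))))) ⟩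
    ∑ n (λ a → ∑ (n ∸ a) (λ b → f a * (g b * h (n ∸ a ∸ b))))
      ≈⟨ ∑-congˡ n (λ a → sym (*-∑ (n ∸ a) (f a) _)) ⟩
    ∑ n (λ a → f a * ∑ (n ∸ a) (λ b → g b * h (n ∸ a ∸ b)))
      ∎

  ⊠-identityˡ : ∀ f → 𝟙 ⊠ f ≋ f
  ⊠-identityˡ f n = trans (∑-single n 0 z≤n 𝟙b*f≈0) (*-identityˡ (f n))
    where
    𝟙b*f≈0 : ∀ b → b ≤ n → b ≢ 0 → 𝟙 b * f (n ∸ b) ≈ 0#
    𝟙b*f≈0 zero    _ 0≢0 with () ← 0≢0 ≡.refl
    𝟙b*f≈0 (suc b) _ _   = zeroˡ _

  ⊠-distribˡ : ∀ f g h → f ⊠ (g ⊞ h) ≋ f ⊠ g ⊞ f ⊠ h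
  ⊠-distribˡ f g h n = trans (∑-congˡ n (λ a → distribˡ (f a) _ _)) (∑-+ n _ _)

  series : CommutativeRing c ℓ
  series = record
    { Carrier = Series ; _≈_ = _≋_ ; _+_ = _⊞_ ; _*_ = _⊠_ ; -_ = ⊟_ ; 0# = 𝟘 ; 1# = 𝟙
    ; isCommutativeRing = record
      { isRing = record
        { +-isAbelianGroup = record
          { isGroup = record
            { isMonoid = record
              { isSemigroup = record
                { isMagma = record
                  { isEquivalence = record
                    { refl = λ n → refl ; sym = λ f≋g n → sym (f≋g n) ; trans = λ f≋g g≋h n → trans (f≋g n) (g≋h n) }
                  ; ∙-cong = λ f≋f′ g≋g′ n → +-cong (f≋f′ n) (g≋g′ n) }
                ; assoc = λ f g h n → +-assoc (f n) (g n) (h n) }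
              ; identity = (λ f n → +-identityˡ (f n)) , (λ f n → +-identityʳ (f n)) }
            ; inverse = (λ f n → -‿inverseˡ (f n)) , (λ f n → -‿inverseʳ (f n))
            ; ⁻¹-cong = λ f≋g n → -‿cong (f≋g n) }
          ; comm = λ f g n → +-comm (f n) (g n) }
        ; *-cong = ⊠-cong
        ; *-assoc = ⊠-assoc
        ; *-identity = ⊠-identityˡ , (λ f → ≋-trans (⊠-comm f 𝟙) (⊠-identityˡ f))
        ; distrib = ⊠-distribˡ , (λ h f g → ≋-trans (⊠-comm (f ⊞ g) h)
                                   (≋-trans (⊠-distribˡ h f g) (λ n → +-cong (⊠-comm h f n) (⊠-comm h g n)))) }
      ; *-comm = ⊠-comm } }
    where
    ≋-trans : ∀ {f g h} → f ≋ g → g ≋ h → f ≋ h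
    ≋-trans f≋g g≋h n = trans (f≋g n) (g≋h n)

  open FiniteSums series public using () renaming (∑ to ∑ₛ)

  ∑ₛ-apply : ∀ n h m → ∑ₛ n h m ≈ ∑ n (λ a → h a m)
  ∑ₛ-apply zero    h m = refl
  ∑ₛ-apply (suc n) h m = +-congʳ (∑ₛ-apply n h m)

  monomial : ℕ → Carrier → Series
  monomial a r n = if a ℕ.≡ᵇ n then r else 0#

  monomial-same : ∀ a r → monomial a r a ≡ r
  monomial-same zero    r = ≡.refl
  monomial-same (suc a) r = monomial-same a r

  monomial-other : ∀ {a n} r → a ≢ n → monomial a r n ≡ 0#
  monomial-other {a} {n} r a≢n with a ℕ.≡ᵇ n in eq
  ... | true  = ⊥-elim (a≢n (ℕ.≡ᵇ⇒≡ a n (≡.subst T (≡.sym eq) tt)))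
  ... | false = ≡.refl

  monomial-cong : ∀ a {r s} → r ≈ s → monomial a r ≋ monomial a s
  monomial-cong a r≈s n with a ℕ.≡ᵇ n
  ... | true  = r≈s
  ... | false = refl

  monomial-⊠ : ∀ a r f n → (monomial a r ⊠ f) (a ℕ.+ n) ≈ r * f n
  monomial-⊠ a r f n = begin
    ∑ (a ℕ.+ n) (λ m → monomial a r m * f (a ℕ.+ n ∸ m))
      ≈⟨ ∑-single (a ℕ.+ n) a (ℕ.m≤m+n a n) (λ m _ m≢a → trans (*-congʳ (reflexive (monomial-other r (m≢a ∘ ≡.sym)))) (zeroˡ _)) ⟩
    monomial a r a * f (a ℕ.+ n ∸ a)
      ≈⟨ *-cong (reflexive (monomial-same a r)) (reflexive (≡.cong f (ℕ.m+n∸m≡n a n))) ⟩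
    r * f n ∎

  monomial-⊠-below : ∀ a r f n → n < a → (monomial a r ⊠ f) n ≈ 0#
  monomial-⊠-below a r f n n<a =
    ∑-zero n (λ m m≤n → trans (*-congʳ (reflexive (monomial-other r (λ a≡m → ℕ.<⇒≱ n<a (≡.subst (_≤ n) (≡.sym a≡m) m≤n))))) (zeroˡ _))

  monomial-⊠-monomial : ∀ a b r s → monomial a r ⊠ monomial b s ≋ monomial (a ℕ.+ b) (r * s)
  monomial-⊠-monomial a b r s n with a ℕ.≤? n
  ... | no  a≰n = trans (monomial-⊠-below a r (monomial b s) n (ℕ.≰⇒> a≰n))
                        (sym (reflexive (monomial-other (r * s) (λ a+b≡n → a≰n (≡.subst (a ≤_) a+b≡n (ℕ.m≤m+n a b))))))
  ... | yes a≤n = ≡.subst (λ m → (monomial a r ⊠ monomial b s) m ≈ monomial (a ℕ.+ b) (r * s) m) (ℕ.m+[n∸m]≡n a≤n)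
                          (trans (monomial-⊠ a r (monomial b s) (n ∸ a)) (shift (n ∸ a)))
    where
    shift : ∀ d → r * monomial b s d ≈ monomial (a ℕ.+ b) (r * s) (a ℕ.+ d)
    shift d with b ℕ.≟ d
    ... | yes ≡.refl = reflexive (≡.trans (≡.cong (r *_) (monomial-same b s)) (≡.sym (monomial-same (a ℕ.+ b) (r * s))))
    ... | no  b≢d    = trans (*-congˡ (reflexive (monomial-other s b≢d)))
                        (trans (zeroʳ r) (sym (reflexive (monomial-other (r * s) (b≢d ∘ ℕ.+-cancelˡ-≡ a _ _)))))

module Diagonal {c ℓ} (R : CommutativeRing c ℓ) where

  open CommutativeRing R
  open FiniteSums R
  open PowerSeries R
  private module S₂ = PowerSeries series
  open import Relation.Binary.Reasoning.Setoid setoid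

  diagonal : (ℕ → ℕ → Carrier) → Series
  diagonal f n = ∑ n (λ j → f j (n ∸ j))

  diagonal-cong : ∀ {f g} → f S₂.≋ g → diagonal f ≋ diagonal g
  diagonal-cong f≋g n = ∑-congˡ n (λ j → f≋g j (n ∸ j))

  diagonal-⊞ : ∀ f g → diagonal (f S₂.⊞ g) ≋ diagonal f ⊞ diagonal g
  diagonal-⊞ f g n = ∑-+ n _ _

  diagonal-⊟ : ∀ f → diagonal (S₂.⊟ f) ≋ ⊟ diagonal f
  diagonal-⊟ f n = ∑-neg n _

  private
    ∑-bound : ∀ {m m′} (h : ℕ → Carrier) → m ≡ m′ → ∑ m h ≈ ∑ m′ h
    ∑-bound h ≡.refl = refl

    ∸-swap : ∀ n a b → n ∸ a ∸ b ≡ n ∸ b ∸ a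
    ∸-swap n a b = ≡.trans (ℕ.∸-+-assoc n a b) (≡.trans (≡.cong (n ∸_) (ℕ.+-comm a b)) (≡.sym (ℕ.∸-+-assoc n b a)))

  -- both sides are sums over compositions n = a + b + a′ + b′ of f a b * g a′ b′
  diagonal-⊠ : ∀ f g → diagonal (f S₂.⊠ g) ≋ diagonal f ⊠ diagonal g
  diagonal-⊠ f g n = trans lhs (sym rhs)
    where
    compositions : Carrier
    compositions = ∑ n (λ a → ∑ (n ∸ a) (λ b → ∑ (n ∸ a ∸ b) (λ a′ → f a b * g a′ (n ∸ a ∸ b ∸ a′))))

    lhs : diagonal (f S₂.⊠ g) n ≈ compositions
    lhs = begin
      ∑ n (λ j → ∑ₛ j (λ a → f a ⊠ g (j ∸ a)) (n ∸ j))
        ≈⟨ ∑-congˡ n (λ j → ∑ₛ-apply j _ (n ∸ j)) ⟩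
      ∑ n (λ j → ∑ j (λ a → ∑ (n ∸ j) (λ b → f a b * g (j ∸ a) (n ∸ j ∸ b))))
        ≈⟨ ∑-triangle n _ ⟩
      ∑ n (λ a → ∑ (n ∸ a) (λ a′ → ∑ (n ∸ (a ℕ.+ a′)) (λ b → f a b * g (a ℕ.+ a′ ∸ a) (n ∸ (a ℕ.+ a′) ∸ b))))
        ≈⟨ ∑-congˡ n (λ a → ∑-congˡ (n ∸ a) (λ a′ → trans (∑-bound _ (≡.sym (ℕ.∸-+-assoc n a a′)))
             (∑-congˡ (n ∸ a ∸ a′) (λ b → *-congˡ (reflexive (≡.cong₂ g (ℕ.m+n∸m≡n a a′)
               (≡.trans (≡.cong (_∸ b) (≡.sym (ℕ.∸-+-assoc n a a′))) (∸-swap (n ∸ a) a′ b)))))))) ⟩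
      ∑ n (λ a → ∑ (n ∸ a) (λ a′ → ∑ (n ∸ a ∸ a′) (λ b → f a b * g a′ (n ∸ a ∸ b ∸ a′))))
        ≈⟨ ∑-congˡ n (λ a → ∑-swap (n ∸ a) (λ a′ b → f a b * g a′ (n ∸ a ∸ b ∸ a′))) ⟩
      compositions ∎

    rhs : (diagonal f ⊠ diagonal g) n ≈ compositions
    rhs = begin
      ∑ n (λ m → diagonal f m * diagonal g (n ∸ m))
        ≈⟨ ∑-congˡ n (λ m → ∑-* m _ _) ⟩
      ∑ n (λ m → ∑ m (λ a → f a (m ∸ a) * diagonal g (n ∸ m)))
        ≈⟨ ∑-triangle n _ ⟩
      ∑ n (λ a → ∑ (n ∸ a) (λ b → f a (a ℕ.+ b ∸ a) * diagonal g (n ∸ (a ℕ.+ b))))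
        ≈⟨ ∑-congˡ n (λ a → ∑-congˡ (n ∸ a) (λ b → trans
             (*-cong (reflexive (≡.cong (f a) (ℕ.m+n∸m≡n a b))) (reflexive (≡.cong (diagonal g) (≡.sym (ℕ.∸-+-assoc n a b)))))
             (*-∑ (n ∸ a ∸ b) (f a b) _))) ⟩
      compositions ∎

  diagonal-monomial : ∀ b c r → diagonal (S₂.monomial b (monomial c r)) ≋ monomial (b ℕ.+ c) r
  diagonal-monomial b c r n with b ℕ.≤? n
  ... | no  b≰n = trans (∑-zero n (λ j j≤n → reflexive (≡.cong (λ h → h (n ∸ j))
                          (S₂.monomial-other (monomial c r) (λ b≡j → b≰n (≡.subst (_≤ n) (≡.sym b≡j) j≤n))))))
                        (sym (reflexive (monomial-other r (λ b+c≡n → b≰n (≡.subst (b ≤_) b+c≡n (ℕ.m≤m+n b c))))))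
  ... | yes b≤n = begin
    ∑ n (λ j → S₂.monomial b (monomial c r) j (n ∸ j))
      ≈⟨ ∑-single n b b≤n (λ j _ j≢b → reflexive (≡.cong (λ h → h (n ∸ j)) (S₂.monomial-other (monomial c r) (j≢b ∘ ≡.sym)))) ⟩
    S₂.monomial b (monomial c r) b (n ∸ b)
      ≡⟨ ≡.cong (λ h → h (n ∸ b)) (S₂.monomial-same b (monomial c r)) ⟩
    monomial c r (n ∸ b)
      ≡⟨ shift (n ∸ b) ⟩
    monomial (b ℕ.+ c) r (b ℕ.+ (n ∸ b))
      ≡⟨ ≡.cong (monomial (b ℕ.+ c) r) (ℕ.m+[n∸m]≡n b≤n) ⟩
    monomial (b ℕ.+ c) r n ∎
    where
    shift : ∀ d → monomial c r d ≡ monomial (b ℕ.+ c) r (b ℕ.+ d)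
    shift d with c ℕ.≟ d
    ... | yes ≡.refl = ≡.trans (monomial-same c r) (≡.sym (monomial-same (b ℕ.+ c) r))
    ... | no  c≢d    = ≡.trans (monomial-other r c≢d) (≡.sym (monomial-other r (c≢d ∘ ℕ.+-cancelˡ-≡ b _ _)))

  diagonal-∑ : ∀ n h → diagonal (S₂.∑ₛ n h) ≋ ∑ₛ n (λ a → diagonal (h a))
  diagonal-∑ zero    h m = refl
  diagonal-∑ (suc n) h m = trans (diagonal-⊞ (S₂.∑ₛ n h) (h (suc n)) m) (+-congʳ (diagonal-∑ n h m))

  diagonal-𝟘 : diagonal S₂.𝟘 ≋ 𝟘
  diagonal-𝟘 n = ∑-zero n (λ _ _ → refl)

module _ {c ℓ} (R : CommutativeRing c ℓ) where

  open CommutativeRing R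

  withOperations : (_+′_ _*′_ : Op₂ Carrier) → (∀ x y → x +′ y ≈ x + y) → (∀ x y → x *′ y ≈ x * y) → CommutativeRing c ℓ
  withOperations _+′_ _*′_ +′≈+ *′≈* = record
    { Carrier = Carrier ; _≈_ = _≈_ ; _+_ = _+′_ ; _*_ = _*′_ ; -_ = -_ ; 0# = 0# ; 1# = 1#
    ; isCommutativeRing = record
      { isRing = record
        { +-isAbelianGroup = record
          { isGroup = record
            { isMonoid = record
              { isSemigroup = record
                { isMagma = record { isEquivalence = isEquivalence ; ∙-cong = lift₂ +′≈+ +-cong }
                ; assoc = λ x y z → trans (+′≈+ _ _) (trans (+-congʳ (+′≈+ x y)) (trans (+-assoc x y z)
                                      (sym (trans (+′≈+ _ _) (+-congˡ (+′≈+ y z)))))) }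
              ; identity = (λ x → trans (+′≈+ _ _) (+-identityˡ x)) , (λ x → trans (+′≈+ _ _) (+-identityʳ x)) }
            ; inverse = (λ x → trans (+′≈+ _ _) (-‿inverseˡ x)) , (λ x → trans (+′≈+ _ _) (-‿inverseʳ x))
            ; ⁻¹-cong = -‿cong }
          ; comm = λ x y → trans (+′≈+ x y) (trans (+-comm x y) (sym (+′≈+ y x))) }
        ; *-cong = lift₂ *′≈* *-cong
        ; *-assoc = λ x y z → trans (*′≈* _ _) (trans (*-congʳ (*′≈* x y)) (trans (*-assoc x y z)
                              (sym (trans (*′≈* _ _) (*-congˡ (*′≈* y z))))))
        ; *-identity = (λ x → trans (*′≈* _ _) (*-identityˡ x)) , (λ x → trans (*′≈* _ _) (*-identityʳ x))
        ; distrib = (λ x y z → trans (*′≈* _ _) (trans (*-congˡ (+′≈+ y z)) (trans (distribˡ x y z)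
                                 (sym (trans (+′≈+ _ _) (+-cong (*′≈* x y) (*′≈* x z)))))))
                  , (λ x y z → trans (*′≈* _ _) (trans (*-congʳ (+′≈+ y z)) (trans (distribʳ x y z)
                                 (sym (trans (+′≈+ _ _) (+-cong (*′≈* y x) (*′≈* z x))))))) }
      ; *-comm = λ x y → trans (*′≈* x y) (trans (*-comm x y) (sym (*′≈* y x))) } }
    where
    lift₂ : ∀ {_∙_ _∘_ : Op₂ Carrier} → (∀ x y → x ∙ y ≈ x ∘ y) → (∀ {x y u v} → x ≈ y → u ≈ v → x ∘ u ≈ y ∘ v) →
            ∀ {x y u v} → x ≈ y → u ≈ v → x ∙ u ≈ y ∙ v
    lift₂ ∙≈∘ ∘-cong x≈y u≈v = trans (∙≈∘ _ _) (trans (∘-cong x≈y u≈v) (sym (∙≈∘ _ _)))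

-- The algebra of the decomposition

-- P counts bargraphs and S their interiors; t marks peaks of width ℓ and w stands for x^ℓ.
record Decomposition {c ℓ} (R : CommutativeRing c ℓ) (t x y w P S : CommutativeRing.Carrier R) : Set ℓ where
  open CommutativeRing R
  field
    bargraphs : P ≈ y * S + (t - 1#) * w * y
    interiors : S ≈ x * (1# + S) + P * (1# + x * (1# + S))

module _ {c ℓ} {R : CommutativeRing c ℓ} where

  open CommutativeRing R

  decomposition-cong : ∀ {t x y w P S t′ x′ y′ w′ P′ S′} → t ≈ t′ → x ≈ x′ → y ≈ y′ → w ≈ w′ → P ≈ P′ → S ≈ S′ →
                       Decomposition R t x y w P S → Decomposition R t′ x′ y′ w′ P′ S′
  decomposition-cong t≈ x≈ y≈ w≈ P≈ S≈ d = record
    { bargraphs = trans (sym P≈) (trans bargraphs (+-cong (*-cong y≈ S≈) (*-cong (*-cong (+-congʳ t≈) w≈) y≈)))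
    ; interiors = trans (sym S≈) (trans interiors (+-cong (*-cong x≈ (+-congˡ S≈)) (*-cong P≈ (+-congˡ (*-cong x≈ (+-congˡ S≈)))))) }
    where open Decomposition d

module _ {c₁ ℓ₁ c₂ ℓ₂} {R₁ : CommutativeRing c₁ ℓ₁} {R₂ : CommutativeRing c₂ ℓ₂}
         {φ : CommutativeRing.Carrier R₁ → CommutativeRing.Carrier R₂}
         (hom : RingMorphisms.IsRingHomomorphism (CommutativeRing.rawRing R₁) (CommutativeRing.rawRing R₂) φ) where

  private
    open RingMorphisms (CommutativeRing.rawRing R₁) (CommutativeRing.rawRing R₂) using (module IsRingHomomorphism)
    module R₁ = CommutativeRing R₁
    open CommutativeRing R₂
    open IsRingHomomorphism hom
    open import Relation.Binary.Reasoning.Setoid setoid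

    minus-homo : ∀ a b → φ (a R₁.- b) ≈ φ a - φ b
    minus-homo a b = trans (+-homo a (R₁.- b)) (+-congˡ (-‿homo b))

    one-plus-homo : ∀ a → φ (R₁.1# R₁.+ a) ≈ 1# + φ a
    one-plus-homo a = trans (+-homo R₁.1# a) (+-congʳ 1#-homo)

  decomposition-image : ∀ {t x y w P S} → Decomposition R₁ t x y w P S →
                        Decomposition R₂ (φ t) (φ x) (φ y) (φ w) (φ P) (φ S)
  decomposition-image {t} {x} {y} {w} {P} {S} d = record
    { bargraphs = begin
        φ P                                                ≈⟨ ⟦⟧-cong bargraphs ⟩
        φ (y R₁.* S R₁.+ (t R₁.- R₁.1#) R₁.* w R₁.* y)     ≈⟨ +-homo _ _ ⟩
        φ (y R₁.* S) + φ ((t R₁.- R₁.1#) R₁.* w R₁.* y)    ≈⟨ +-cong (*-homo y S) (trans (*-homo _ y) (*-congʳ (*-homo _ w))) ⟩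
        φ y * φ S + φ (t R₁.- R₁.1#) * φ w * φ y            ≈⟨ +-congˡ (*-congʳ (*-congʳ (trans (minus-homo t R₁.1#) (+-congˡ (-‿cong 1#-homo))))) ⟩
        φ y * φ S + (φ t - 1#) * φ w * φ y                 ∎
    ; interiors = begin
        φ S                                                                    ≈⟨ ⟦⟧-cong interiors ⟩
        φ (x R₁.* (R₁.1# R₁.+ S) R₁.+ P R₁.* (R₁.1# R₁.+ x R₁.* (R₁.1# R₁.+ S))) ≈⟨ +-homo _ _ ⟩
        φ (x R₁.* (R₁.1# R₁.+ S)) + φ (P R₁.* (R₁.1# R₁.+ x R₁.* (R₁.1# R₁.+ S))) ≈⟨ +-cong (*-homo x _) (*-homo P _) ⟩
        φ x * φ (R₁.1# R₁.+ S) + φ P * φ (R₁.1# R₁.+ x R₁.* (R₁.1# R₁.+ S))        ≈⟨ +-cong (*-congˡ (one-plus-homo S))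
                                                                                        (*-congˡ (trans (one-plus-homo _) (+-congˡ (trans (*-homo x _) (*-congˡ (one-plus-homo S)))))) ⟩
        φ x * (1# + φ S) + φ P * (1# + φ x * (1# + φ S))                          ∎ }
    where open Decomposition d

module BargraphEquations {c ℓ} (R : CommutativeRing c ℓ) where

  open CommutativeRing R
  open IntegerCoefficients R
  open import Algebra.Properties.Group +-group using (x≈y⇒x∙y⁻¹≈ε)
  open import Relation.Binary.Reasoning.Setoid setoid

  private
    one nil : ∀ {n} → Polynomial n
    one = con (+ 1)
    nil = con (+ 0)

  functionalEquation : ∀ {t x y w P S} → Decomposition R t x y w P S →
    x * P * P - (1# - x - y - x * y - (1# - t) * (x * w * y)) * P + y * (x - (1# - t) * (1# - x) * w) ≈ 0#
  functionalEquation {t} {x} {y} {w} {P} {S} d = begin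
    x * P * P - (1# - x - y - x * y - (1# - t) * (x * w * y)) * P + y * (x - (1# - t) * (1# - x) * w)
      ≈⟨ solve 6 (λ t x y w P S →
           x :* P :* P :- (one :- x :- y :- x :* y :- (one :- t) :* (x :* w :* y)) :* P :+ y :* (x :- (one :- t) :* (one :- x) :* w)
           := y :* (x :* (one :+ S) :+ P :* (one :+ x :* (one :+ S)) :- S) :- (one :- x :- x :* P) :* (P :- (y :* S :+ (t :- one) :* w :* y)))
           refl t x y w P S ⟩
    y * (x * (1# + S) + P * (1# + x * (1# + S)) - S) - (1# - x - x * P) * (P - (y * S + (t - 1#) * w * y))
      ≈⟨ +-cong (*-congˡ (x≈y⇒x∙y⁻¹≈ε (sym interiors))) (-‿cong (*-congˡ (x≈y⇒x∙y⁻¹≈ε bargraphs))) ⟩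
    y * 0# - (1# - x - x * P) * 0#
      ≈⟨ solve 3 (λ x y P → y :* nil :- (one :- x :- x :* P) :* nil := nil) refl x y P ⟩
    0# ∎
    where open Decomposition d

  -- the statement writes 1, xy and x^(ℓ+1)y as monomials of their own
  functionalEquation-monomials : ∀ {t x y w P S} → Decomposition R t x y w P S → ∀ {o xy xwy} → o ≈ 1# → xy ≈ x * y → xwy ≈ x * w * y →
    x * P * P - (o - x - y - xy - (o - t) * xwy) * P + y * (x - (o - t) * (o - x) * w) ≈ 0#
  functionalEquation-monomials d o≈1 xy≈ xwy≈ = trans
    (+-cong (+-congˡ (-‿cong (*-congʳ (+-cong (+-cong (+-congʳ (+-congʳ o≈1)) (-‿cong xy≈)) (-‿cong (*-cong (+-congʳ o≈1) xwy≈))))))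
            (*-congˡ (+-congˡ (-‿cong (*-congʳ (*-cong (+-congʳ o≈1) (+-congʳ o≈1)))))))
    (functionalEquation d)

  discriminant : ∀ {a b c q} → a * q * q - b * q + c ≈ 0# →
    (b - (a + a) * q) * (b - (a + a) * q) ≈ b * b - (a + a + a + a) * c
  discriminant {a} {b} {c} {q} e = begin
    (b - (a + a) * q) * (b - (a + a) * q)
      ≈⟨ solve 4 (λ a b c q → (b :- (a :+ a) :* q) :* (b :- (a :+ a) :* q)
                              := b :* b :- (a :+ a :+ a :+ a) :* c :+ (a :+ a :+ a :+ a) :* (a :* q :* q :- b :* q :+ c)) refl a b c q ⟩
    b * b - (a + a + a + a) * c + (a + a + a + a) * (a * q * q - b * q + c)
      ≈⟨ +-congˡ (trans (*-congˡ e) (zeroʳ _)) ⟩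
    b * b - (a + a + a + a) * c + 0#
      ≈⟨ +-identityʳ _ ⟩
    b * b - (a + a + a + a) * c ∎

  -- the atoms o, o₂, z₂, … are the monomials 1, 2, 2z, … as the statement writes them
  squareRoot : ∀ {t z w Q S} → Decomposition R t z z w Q S →
    ∀ {o o₂ z₂ z₄ zz zz₂ zzzz zzw zzzzww} → o ≈ 1# → o₂ ≈ 1# + 1# → z₂ ≈ z + z → z₄ ≈ z + z + z + z → zz ≈ z * z →
      zz₂ ≈ z * z + z * z → zzzz ≈ z * z * z * z → zzw ≈ z * z * w → zzzzww ≈ z * z * z * z * w * w →
    (o - z₂ - zz + (t - o) * zzw - z₂ * Q) * (o - z₂ - zz + (t - o) * zzw - z₂ * Q)
    ≈ o - z₄ + zz₂ + zzzz + o₂ * (o - t) * zzw * (o + zz) + (o - t) * (o - t) * zzzzww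
  squareRoot {t} {z} {w} {Q} d o≈ o₂≈ z₂≈ z₄≈ zz≈ zz₂≈ zzzz≈ zzw≈ zzzzww≈ = begin
    _ * _
      ≈⟨ *-cong s≈ s≈ ⟩
    (b - (z + z) * Q) * (b - (z + z) * Q)
      ≈⟨ discriminant (functionalEquation d) ⟩
    b * b - (z + z + z + z) * (z * (z - (1# - t) * (1# - z) * w))
      ≈⟨ solve 3 (λ t z w →
           B t z w :* B t z w :- (z :+ z :+ z :+ z) :* (z :* (z :- (one :- t) :* (one :- z) :* w))
           := one :- (z :+ z :+ z :+ z) :+ (z :* z :+ z :* z) :+ z :* z :* z :* z :+ (one :+ one) :* (one :- t) :* (z :* z :* w) :* (one :+ z :* z)
              :+ (one :- t) :* (one :- t) :* (z :* z :* z :* z :* w :* w)) refl t z w ⟩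
    1# - (z + z + z + z) + (z * z + z * z) + z * z * z * z + (1# + 1#) * (1# - t) * (z * z * w) * (1# + z * z)
      + (1# - t) * (1# - t) * (z * z * z * z * w * w)
      ≈⟨ +-cong (+-cong (+-cong (+-cong (+-cong o≈ (-‿cong z₄≈)) zz₂≈) zzzz≈)
                        (*-cong (*-cong (*-cong o₂≈ (+-congʳ o≈)) zzw≈) (+-cong o≈ zz≈)))
                (*-cong (*-cong (+-congʳ o≈) (+-congʳ o≈)) zzzzww≈) ⟨
    _ ∎
    where
    B : ∀ {n} → Polynomial n → Polynomial n → Polynomial n → Polynomial n
    B t z w = one :- z :- z :- z :* z :- (one :- t) :* (z :* w :* z)
    b = 1# - z - z - z * z - (1# - t) * (z * w * z)
    s≈ = trans (+-cong (+-cong (+-cong (+-cong o≈ (-‿cong z₂≈)) (-‿cong zz≈)) (*-cong (+-congˡ (-‿cong o≈)) zzw≈)) (-‿cong (*-congʳ z₂≈)))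
               (+-congʳ (solve 3 (λ t z w → one :- (z :+ z) :- z :* z :+ (t :- one) :* (z :* z :* w) := B t z w) refl t z w))

open Defs using (Step; U; H; D; words)

module WordSums {c ℓ} (R : CommutativeRing c ℓ) where

  open CommutativeRing R
  open FiniteSums R
  open IntegerCoefficients R using (solve; _:=_; _:+_; _:*_)
  open import Algebra.Properties.CommutativeSemigroup +-commutativeSemigroup using (interchange)
  open import Relation.Binary.Reasoning.Setoid setoid

  Weight : Set c
  Weight = List Step → Carrier

  ∑ˡ : ∀ {A : Set} → List A → (A → Carrier) → Carrier
  ∑ˡ xs f = foldr (λ x s → f x + s) 0# xs

  ∑ˡ-cong : ∀ {A : Set} (xs : List A) {f g} → (∀ x → f x ≈ g x) → ∑ˡ xs f ≈ ∑ˡ xs g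
  ∑ˡ-cong []       f≈g = refl
  ∑ˡ-cong (x ∷ xs) f≈g = +-cong (f≈g x) (∑ˡ-cong xs f≈g)

  ∑ˡ-+ : ∀ {A : Set} (xs : List A) f g → ∑ˡ xs (λ x → f x + g x) ≈ ∑ˡ xs f + ∑ˡ xs g
  ∑ˡ-+ []       f g = sym (+-identityˡ 0#)
  ∑ˡ-+ (x ∷ xs) f g = trans (+-congˡ (∑ˡ-+ xs f g)) (interchange _ _ _ _)

  ∑ˡ-++ : ∀ {A : Set} (xs ys : List A) f → ∑ˡ (xs ++ ys) f ≈ ∑ˡ xs f + ∑ˡ ys f
  ∑ˡ-++ []       ys f = sym (+-identityˡ _)
  ∑ˡ-++ (x ∷ xs) ys f = trans (+-congˡ (∑ˡ-++ xs ys f)) (sym (+-assoc _ _ _))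

  *-∑ˡ : ∀ {A : Set} (xs : List A) a f → a * ∑ˡ xs f ≈ ∑ˡ xs (λ x → a * f x)
  *-∑ˡ []       a f = zeroʳ a
  *-∑ˡ (x ∷ xs) a f = trans (distribˡ a _ _) (+-congˡ (*-∑ˡ xs a f))

  ∑ʷ : ℕ → Weight → Carrier
  ∑ʷ n = ∑ˡ (words n)

  ∑ʷ-cong : ∀ n {f g} → (∀ w → f w ≈ g w) → ∑ʷ n f ≈ ∑ʷ n g
  ∑ʷ-cong n = ∑ˡ-cong (words n)

  ∑ʷ-+ : ∀ n f g → ∑ʷ n (λ w → f w + g w) ≈ ∑ʷ n f + ∑ʷ n g
  ∑ʷ-+ n = ∑ˡ-+ (words n)

  *-∑ʷ : ∀ n a f → a * ∑ʷ n f ≈ ∑ʷ n (λ w → a * f w)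
  *-∑ʷ n = *-∑ˡ (words n)

  ∑ʷ-[] : ∀ f → ∑ʷ 0 f ≈ f []
  ∑ʷ-[] f = +-identityʳ (f [])

  ∑ʷ-∷ : ∀ n f → ∑ʷ (suc n) f ≈ ∑ʷ n (f ∘ (U ∷_)) + ∑ʷ n (f ∘ (H ∷_)) + ∑ʷ n (f ∘ (D ∷_))
  ∑ʷ-∷ n f = begin
    ∑ˡ (concatMap (λ w → (U ∷ w) ∷ (H ∷ w) ∷ (D ∷ w) ∷ []) (words n)) f
      ≈⟨ concat (words n) ⟩
    ∑ʷ n (λ w → f (U ∷ w) + (f (H ∷ w) + (f (D ∷ w) + 0#)))
      ≈⟨ ∑ʷ-cong n (λ w → trans (+-congˡ (+-congˡ (+-identityʳ _))) (sym (+-assoc _ _ _))) ⟩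
    ∑ʷ n (λ w → f (U ∷ w) + f (H ∷ w) + f (D ∷ w))
      ≈⟨ trans (∑ʷ-+ n _ _) (+-congʳ (∑ʷ-+ n _ _)) ⟩
    ∑ʷ n (f ∘ (U ∷_)) + ∑ʷ n (f ∘ (H ∷_)) + ∑ʷ n (f ∘ (D ∷_)) ∎
    where
    concat : ∀ ws → ∑ˡ (concatMap (λ w → (U ∷ w) ∷ (H ∷ w) ∷ (D ∷ w) ∷ []) ws) f
                    ≈ ∑ˡ ws (λ w → f (U ∷ w) + (f (H ∷ w) + (f (D ∷ w) + 0#)))
    concat []       = refl
    concat (w ∷ ws) = trans (∑ˡ-++ ((U ∷ w) ∷ (H ∷ w) ∷ (D ∷ w) ∷ []) (concatMap (λ w → (U ∷ w) ∷ (H ∷ w) ∷ (D ∷ w) ∷ []) ws) f) (+-congˡ (concat ws))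

  ∑ʷ-vanish : ∀ n {f} → (∀ w → length w ≡ n → f w ≈ 0#) → ∑ʷ n f ≈ 0#
  ∑ʷ-vanish zero    {f} f≈0 = trans (∑ʷ-[] f) (f≈0 [] ≡.refl)
  ∑ʷ-vanish (suc n) {f} f≈0 = begin
    ∑ʷ (suc n) f ≈⟨ ∑ʷ-∷ n f ⟩
    _ + _ + _    ≈⟨ +-cong (+-cong (branch U) (branch H)) (branch D) ⟩
    0# + 0# + 0# ≈⟨ trans (+-identityʳ _) (+-identityʳ 0#) ⟩
    0#           ∎
    where
    branch : ∀ s → ∑ʷ n (f ∘ (s ∷_)) ≈ 0#
    branch s = ∑ʷ-vanish n (λ w |w|≡n → f≈0 (s ∷ w) (≡.cong suc |w|≡n))

  ∑ʷ-single : ∀ v {f} → (∀ w → length w ≡ length v → w ≢ v → f w ≈ 0#) → ∑ʷ (length v) f ≈ f v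
  ∑ʷ-single []      {f} f≈0 = ∑ʷ-[] f
  ∑ʷ-single (s ∷ v) {f} f≈0 = trans (∑ʷ-∷ (length v) f) (pick s f≈0)
    where
    same : ∀ t → (∀ w → length w ≡ length (t ∷ v) → w ≢ t ∷ v → f w ≈ 0#) → ∑ʷ (length v) (f ∘ (t ∷_)) ≈ f (t ∷ v)
    same t f≈0 = ∑ʷ-single v (λ w |w|≡ w≢v → f≈0 (t ∷ w) (≡.cong suc |w|≡) (w≢v ∘ List.∷-injectiveʳ))
    other : ∀ t {s} → (∀ w → length w ≡ length (s ∷ v) → w ≢ s ∷ v → f w ≈ 0#) → t ≢ s → ∑ʷ (length v) (f ∘ (t ∷_)) ≈ 0#
    other t f≈0 t≢s = ∑ʷ-vanish (length v) (λ w |w|≡ → f≈0 (t ∷ w) (≡.cong suc |w|≡) (t≢s ∘ List.∷-injectiveˡ))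
    pick : ∀ s → (∀ w → length w ≡ length (s ∷ v) → w ≢ s ∷ v → f w ≈ 0#) →
           ∑ʷ (length v) (f ∘ (U ∷_)) + ∑ʷ (length v) (f ∘ (H ∷_)) + ∑ʷ (length v) (f ∘ (D ∷_)) ≈ f (s ∷ v)
    pick U f≈0 = trans (+-cong (+-cong (same U f≈0) (other H f≈0 λ ())) (other D f≈0 λ ())) (trans (+-identityʳ _) (+-identityʳ _))
    pick H f≈0 = trans (+-cong (+-cong (other U f≈0 λ ()) (same H f≈0)) (other D f≈0 λ ())) (trans (+-identityʳ _) (+-identityˡ _))
    pick D f≈0 = trans (+-cong (+-cong (other U f≈0 λ ()) (other H f≈0 λ ())) (same D f≈0)) (trans (+-congʳ (+-identityʳ 0#)) (+-identityˡ _))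

  ∑ʷ-∷ʳ : ∀ n f → ∑ʷ (suc n) f ≈ ∑ʷ n (λ w → f (w ++ [ U ])) + ∑ʷ n (λ w → f (w ++ [ H ])) + ∑ʷ n (λ w → f (w ++ [ D ]))
  ∑ʷ-∷ʳ zero    f = ∑ʷ-∷ 0 f
  ∑ʷ-∷ʳ (suc n) f = begin
    ∑ʷ (suc (suc n)) f
      ≈⟨ ∑ʷ-∷ (suc n) f ⟩
    ∑ʷ (suc n) (f ∘ (U ∷_)) + ∑ʷ (suc n) (f ∘ (H ∷_)) + ∑ʷ (suc n) (f ∘ (D ∷_))
      ≈⟨ +-cong (+-cong (∑ʷ-∷ʳ n _) (∑ʷ-∷ʳ n _)) (∑ʷ-∷ʳ n _) ⟩
    (framed U U + framed U H + framed U D) + (framed H U + framed H H + framed H D) + (framed D U + framed D H + framed D D)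
      ≈⟨ solve 9 (λ a b c d e f g h i → (a :+ b :+ c) :+ (d :+ e :+ f) :+ (g :+ h :+ i)
                                      := (a :+ d :+ g) :+ (b :+ e :+ h) :+ (c :+ f :+ i))
               refl (framed U U) (framed U H) (framed U D) (framed H U) (framed H H) (framed H D) (framed D U) (framed D H) (framed D D) ⟩
    (framed U U + framed H U + framed D U) + (framed U H + framed H H + framed D H) + (framed U D + framed H D + framed D D)
      ≈⟨ +-cong (+-cong (∑ʷ-∷ n _) (∑ʷ-∷ n _)) (∑ʷ-∷ n _) ⟨
    ∑ʷ (suc n) (λ w → f (w ++ [ U ])) + ∑ʷ (suc n) (λ w → f (w ++ [ H ])) + ∑ʷ (suc n) (λ w → f (w ++ [ D ])) ∎
    where
    framed : Step → Step → Carrier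
    framed s t = ∑ʷ n (λ w → f (s ∷ w ++ [ t ]))

  infixl 7 _⋆_
  _⋆_ : Weight → Weight → Weight
  (f ⋆ g) []      = f [] * g []
  (f ⋆ g) (s ∷ w) = f [] * g (s ∷ w) + ((f ∘ (s ∷_)) ⋆ g) w

  ∑ʷ-⋆ : ∀ n f g → ∑ʷ n (f ⋆ g) ≈ ∑ n (λ a → ∑ʷ a f * ∑ʷ (n ∸ a) g)
  ∑ʷ-⋆ zero    f g = trans (∑ʷ-[] (f ⋆ g)) (sym (*-cong (∑ʷ-[] f) (∑ʷ-[] g)))
  ∑ʷ-⋆ (suc n) f g = begin
    ∑ʷ (suc n) (f ⋆ g)
      ≈⟨ ∑ʷ-∷ n (f ⋆ g) ⟩
    first U + first H + first D
      ≈⟨ +-cong (+-cong (step U) (step H)) (step D) ⟩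
    (f [] * ∑ʷ n (g ∘ (U ∷_)) + rest U) + (f [] * ∑ʷ n (g ∘ (H ∷_)) + rest H) + (f [] * ∑ʷ n (g ∘ (D ∷_)) + rest D)
      ≈⟨ solve 7 (λ x a b c p q r → (x :* a :+ p) :+ (x :* b :+ q) :+ (x :* c :+ r) := x :* (a :+ b :+ c) :+ (p :+ q :+ r))
               refl (f []) (∑ʷ n (g ∘ (U ∷_))) (∑ʷ n (g ∘ (H ∷_))) (∑ʷ n (g ∘ (D ∷_))) (rest U) (rest H) (rest D) ⟩
    f [] * (∑ʷ n (g ∘ (U ∷_)) + ∑ʷ n (g ∘ (H ∷_)) + ∑ʷ n (g ∘ (D ∷_))) + (rest U + rest H + rest D)
      ≈⟨ +-cong (*-cong (sym (∑ʷ-[] f)) (sym (∑ʷ-∷ n g))) (sym rests) ⟩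
    ∑ʷ 0 f * ∑ʷ (suc n) g + ∑ n (λ a → ∑ʷ (suc a) f * ∑ʷ (n ∸ a) g)
      ≈⟨ ∑-suc n (λ a → ∑ʷ a f * ∑ʷ (suc n ∸ a) g) ⟨
    ∑ (suc n) (λ a → ∑ʷ a f * ∑ʷ (suc n ∸ a) g) ∎
    where
    first rest : Step → Carrier
    first s = ∑ʷ n ((f ⋆ g) ∘ (s ∷_))
    rest s = ∑ n (λ a → ∑ʷ a (f ∘ (s ∷_)) * ∑ʷ (n ∸ a) g)
    step : ∀ s → first s ≈ f [] * ∑ʷ n (g ∘ (s ∷_)) + rest s
    step s = trans (∑ʷ-+ n _ _) (+-cong (sym (*-∑ʷ n (f []) _)) (∑ʷ-⋆ n (f ∘ (s ∷_)) g))
    rests : ∑ n (λ a → ∑ʷ (suc a) f * ∑ʷ (n ∸ a) g) ≈ rest U + rest H + rest D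
    rests = begin
      ∑ n (λ a → ∑ʷ (suc a) f * ∑ʷ (n ∸ a) g)
        ≈⟨ ∑-congˡ n (λ a → trans (*-congʳ (∑ʷ-∷ a f)) (trans (distribʳ _ _ _) (+-congʳ (distribʳ _ _ _)))) ⟩
      ∑ n (λ a → ∑ʷ a (f ∘ (U ∷_)) * ∑ʷ (n ∸ a) g + ∑ʷ a (f ∘ (H ∷_)) * ∑ʷ (n ∸ a) g + ∑ʷ a (f ∘ (D ∷_)) * ∑ʷ (n ∸ a) g)
        ≈⟨ trans (∑-+ n _ _) (+-congʳ (∑-+ n _ _)) ⟩
      rest U + rest H + rest D ∎

  ⋆-vanish : ∀ w {f g} → (∀ u v → u ++ v ≡ w → f u * g v ≈ 0#) → (f ⋆ g) w ≈ 0#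
  ⋆-vanish []      fg≈0 = fg≈0 [] [] ≡.refl
  ⋆-vanish (s ∷ w) fg≈0 = trans (+-cong (fg≈0 [] (s ∷ w) ≡.refl) (⋆-vanish w (λ u v uv≡w → fg≈0 (s ∷ u) v (≡.cong (s ∷_) uv≡w))))
                                (+-identityˡ 0#)

  ⋆-single : ∀ u v {f g} → (∀ u′ v′ → u′ ++ v′ ≡ u ++ v → u′ ≢ u → f u′ * g v′ ≈ 0#) → (f ⋆ g) (u ++ v) ≈ f u * g v
  ⋆-single []      []      fg≈0 = refl
  ⋆-single []      (s ∷ v) fg≈0 = trans (+-congˡ (⋆-vanish v (λ u′ v′ eq → fg≈0 (s ∷ u′) v′ (≡.cong (s ∷_) eq) λ ()))) (+-identityʳ _)
  ⋆-single (s ∷ u) v      fg≈0 = trans (+-cong (fg≈0 [] (s ∷ u ++ v) ≡.refl λ ())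
                                             (⋆-single u v (λ u′ v′ eq u′≢u → fg≈0 (s ∷ u′) v′ (≡.cong (s ∷_) eq) (u′≢u ∘ List.∷-injectiveʳ))))
                                      (+-identityˡ _)

open import Data.Nat using (_+_; _*_)
open import Data.Product using (_×_)
open import Relation.Binary.PropositionalEquality using (refl)
open Defs

-- Walks

-- Heights are relative: `endHeight h w` walks from height h, allowing H steps at height 0.
endHeight : ℕ → List Step → Maybe ℕ
endHeight h       []      = just h
endHeight h       (U ∷ w) = endHeight (suc h) w
endHeight h       (H ∷ w) = endHeight h w
endHeight zero    (D ∷ w) = nothing
endHeight (suc h) (D ∷ w) = endHeight h w

returns : Maybe ℕ → Bool
returns (just zero) = true
returns _           = false

returns⇒≡just0 : ∀ m → returns m ≡ true → m ≡ just 0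
returns⇒≡just0 (just zero) _ = refl

private
  ∧-left : ∀ {a b} → a ∧ b ≡ true → a ≡ true
  ∧-left {true} _ = refl

  lastStep : Maybe ℕ → Step → Bool
  lastStep nothing  x = false
  lastStep (just h) x = run (suc h) [ x ]

  continue-∷ʳ : ∀ h w x → continue (suc h) (w ++ [ x ]) ≡ run (suc h) (w ++ [ x ])
  continue-∷ʳ h []      x = refl
  continue-∷ʳ h (y ∷ w) x = refl

  continue0-∷ʳ : ∀ w x → continue 0 (w ++ [ x ]) ≡ false
  continue0-∷ʳ []      x = refl
  continue0-∷ʳ (y ∷ w) x = refl

  run-∷ʳ : ∀ h w x → run (suc h) (w ++ [ x ]) ≡ lastStep (endHeight h w) x
  run-∷ʳ h       []      x = refl
  run-∷ʳ h       (U ∷ w) x = ≡.trans (continue-∷ʳ (suc h) w x) (run-∷ʳ (suc h) w x)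
  run-∷ʳ h       (H ∷ w) x = ≡.trans (continue-∷ʳ h w x) (run-∷ʳ h w x)
  run-∷ʳ zero    (D ∷ w) x = continue0-∷ʳ w x
  run-∷ʳ (suc h) (D ∷ w) x = ≡.trans (continue-∷ʳ h w x) (run-∷ʳ h w x)

run-wrapD : ∀ s → run 0 (U ∷ s ++ [ D ]) ≡ returns (endHeight 0 s)
run-wrapD s = ≡.trans (continue-∷ʳ 0 s D) (≡.trans (run-∷ʳ 0 s D) (lastD (endHeight 0 s)))
  where
  lastD : ∀ m → lastStep m D ≡ returns m
  lastD nothing        = refl
  lastD (just zero)    = refl
  lastD (just (suc h)) = refl

run-wrapU : ∀ s → run 0 (U ∷ s ++ [ U ]) ≡ false
run-wrapU s = ≡.trans (continue-∷ʳ 0 s U) (≡.trans (run-∷ʳ 0 s U) (lastU (endHeight 0 s)))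
  where
  lastU : ∀ m → lastStep m U ≡ false
  lastU nothing  = refl
  lastU (just h) = refl

run-wrapH : ∀ s → run 0 (U ∷ s ++ [ H ]) ≡ false
run-wrapH s = ≡.trans (continue-∷ʳ 0 s H) (≡.trans (run-∷ʳ 0 s H) (lastH (endHeight 0 s)))
  where
  lastH : ∀ m → lastStep m H ≡ false
  lastH nothing  = refl
  lastH (just h) = refl

interior : List Step → Bool
interior []      = false
interior (x ∷ s) = returns (endHeight 0 (x ∷ s)) ∧ noUDDU (x ∷ s)

private
  notEndingInU : List Step → Bool
  notEndingInU []          = true
  notEndingInU (U ∷ [])    = false
  notEndingInU (_ ∷ [])    = true
  notEndingInU (_ ∷ y ∷ s) = notEndingInU (y ∷ s)

  noUDDU-∷ʳD : ∀ w → noUDDU (w ++ [ D ]) ≡ noUDDU w ∧ notEndingInU w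
  noUDDU-∷ʳD []          = refl
  noUDDU-∷ʳD (U ∷ [])    = refl
  noUDDU-∷ʳD (H ∷ [])    = refl
  noUDDU-∷ʳD (D ∷ [])    = refl
  noUDDU-∷ʳD (U ∷ U ∷ s) = noUDDU-∷ʳD (U ∷ s)
  noUDDU-∷ʳD (U ∷ H ∷ s) = noUDDU-∷ʳD (H ∷ s)
  noUDDU-∷ʳD (U ∷ D ∷ s) = refl
  noUDDU-∷ʳD (H ∷ U ∷ s) = noUDDU-∷ʳD (U ∷ s)
  noUDDU-∷ʳD (H ∷ H ∷ s) = noUDDU-∷ʳD (H ∷ s)
  noUDDU-∷ʳD (H ∷ D ∷ s) = noUDDU-∷ʳD (D ∷ s)
  noUDDU-∷ʳD (D ∷ U ∷ s) = refl
  noUDDU-∷ʳD (D ∷ H ∷ s) = noUDDU-∷ʳD (H ∷ s)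
  noUDDU-∷ʳD (D ∷ D ∷ s) = noUDDU-∷ʳD (D ∷ s)

  returning⇒notEndingInU : ∀ h w → endHeight h w ≡ just 0 → notEndingInU w ≡ true
  returning⇒notEndingInU h       []          _  = refl
  returning⇒notEndingInU h       (U ∷ [])    ()
  returning⇒notEndingInU h       (H ∷ [])    _  = refl
  returning⇒notEndingInU h       (D ∷ [])    _  = refl
  returning⇒notEndingInU h       (U ∷ y ∷ s) eq = returning⇒notEndingInU (suc h) (y ∷ s) eq
  returning⇒notEndingInU h       (H ∷ y ∷ s) eq = returning⇒notEndingInU h (y ∷ s) eq
  returning⇒notEndingInU (suc h) (D ∷ y ∷ s) eq = returning⇒notEndingInU h (y ∷ s) eq

isBargraph-wrap : ∀ s → isBargraph (U ∷ s ++ [ D ]) ≡ interior s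
isBargraph-wrap []      = refl
isBargraph-wrap (x ∷ s) = ≡.trans (≡.cong (_∧ noUDDU (U ∷ x ∷ s ++ [ D ])) (run-wrapD (x ∷ s))) (unwrapped x)
  where
  unwrapped : ∀ x → returns (endHeight 0 (x ∷ s)) ∧ noUDDU (U ∷ x ∷ s ++ [ D ]) ≡ interior (x ∷ s)
  unwrapped x with returns (endHeight 0 (x ∷ s)) in eq
  ... | false = refl
  ... | true  = ≡.trans (noUDDU-∷ʳD (U ∷ x ∷ s))
                  (≡.trans (≡.cong (noUDDU (U ∷ x ∷ s) ∧_) (returning⇒notEndingInU 0 (x ∷ s) (returns⇒≡just0 _ eq)))
                  (≡.trans (∧-identityʳ _) (unwrap x eq)))
    where
    unwrap : ∀ x → returns (endHeight 0 (x ∷ s)) ≡ true → noUDDU (U ∷ x ∷ s) ≡ noUDDU (x ∷ s)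
    unwrap U _ = refl
    unwrap H _ = refl

noUDDU-split : ∀ w v → noUDDU (w ++ D ∷ v) ≡ noUDDU (w ++ [ D ]) ∧ noUDDU (D ∷ v)
noUDDU-split []          []      = refl
noUDDU-split []          (U ∷ v) = refl
noUDDU-split []          (H ∷ v) = refl
noUDDU-split []          (D ∷ v) = refl
noUDDU-split (U ∷ [])    v       = refl
noUDDU-split (H ∷ [])    v       = refl
noUDDU-split (D ∷ [])    v       = refl
noUDDU-split (U ∷ U ∷ s) v       = noUDDU-split (U ∷ s) v
noUDDU-split (U ∷ H ∷ s) v       = noUDDU-split (H ∷ s) v
noUDDU-split (U ∷ D ∷ s) v       = refl
noUDDU-split (H ∷ U ∷ s) v       = noUDDU-split (U ∷ s) v
noUDDU-split (H ∷ H ∷ s) v       = noUDDU-split (H ∷ s) v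
noUDDU-split (H ∷ D ∷ s) v       = noUDDU-split (D ∷ s) v
noUDDU-split (D ∷ U ∷ s) v       = refl
noUDDU-split (D ∷ H ∷ s) v       = noUDDU-split (H ∷ s) v
noUDDU-split (D ∷ D ∷ s) v       = noUDDU-split (D ∷ s) v

count-++ : ∀ x u v → count x (u ++ v) ≡ count x u + count x v
count-++ x []      v = refl
count-++ x (y ∷ u) v = ≡.trans (≡.cong (ℕ._+_ (if eqStep x y then 1 else 0)) (count-++ x u v)) (≡.sym (ℕ.+-assoc _ (count x u) (count x v)))

endHeight-++ : ∀ h u v → endHeight h (u ++ v) ≡ (endHeight h u >>= λ h′ → endHeight h′ v)
endHeight-++ h       []      v = refl
endHeight-++ h       (U ∷ u) v = endHeight-++ (suc h) u v
endHeight-++ h       (H ∷ u) v = endHeight-++ h u v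
endHeight-++ zero    (D ∷ u) v = refl
endHeight-++ (suc h) (D ∷ u) v = endHeight-++ h u v

endHeight-suc : ∀ h a {h′} → endHeight h a ≡ just h′ → endHeight (suc h) a ≡ just (suc h′)
endHeight-suc h       []      refl = refl
endHeight-suc h       (U ∷ a) eq   = endHeight-suc (suc h) a eq
endHeight-suc h       (H ∷ a) eq   = endHeight-suc h a eq
endHeight-suc (suc h) (D ∷ a) eq   = endHeight-suc h a eq

wrap-returns : ∀ a v → endHeight 0 a ≡ just 0 → endHeight 1 (a ++ D ∷ v) ≡ endHeight 0 v
wrap-returns a v eq = ≡.trans (endHeight-++ 1 a (D ∷ v)) (≡.cong (_>>= λ h′ → endHeight h′ (D ∷ v)) (endHeight-suc 0 a eq))

-- The first return of a walk from height k + 1 to height k.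
firstReturn : ∀ k h r → endHeight (k + suc h) r ≡ just 0 →
              ∃₂ λ a b → r ≡ a ++ D ∷ b × endHeight k a ≡ just 0 × endHeight h b ≡ just 0
firstReturn k       h []      eq with () ← ≡.trans (≡.cong just (≡.sym (ℕ.+-suc k h))) eq
firstReturn k       h (U ∷ r) eq with firstReturn (suc k) h r eq
... | a , b , refl , ea , eb = U ∷ a , b , refl , ea , eb
firstReturn k       h (H ∷ r) eq with firstReturn k h r eq
... | a , b , refl , ea , eb = H ∷ a , b , refl , ea , eb
firstReturn zero    h (D ∷ r) eq = [] , r , refl , refl , eq
firstReturn (suc k) h (D ∷ r) eq with firstReturn k h r eq
... | a , b , refl , ea , eb = D ∷ a , b , refl , ea , eb

firstReturn-unique : ∀ h a₁ a₂ {r₁ r₂} → endHeight h a₁ ≡ just 0 → endHeight h a₂ ≡ just 0 → a₁ ++ D ∷ r₁ ≡ a₂ ++ D ∷ r₂ → a₁ ≡ a₂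
firstReturn-unique h       []       []       _  _  _  = refl
firstReturn-unique .0      []       (U ∷ a₂) refl _  ()
firstReturn-unique .0      []       (H ∷ a₂) refl _  ()
firstReturn-unique .0      (U ∷ a₁) []       _  refl ()
firstReturn-unique .0      (H ∷ a₁) []       _  refl ()
firstReturn-unique h       (U ∷ a₁) (U ∷ a₂) e₁ e₂ eq = ≡.cong (U ∷_) (firstReturn-unique (suc h) a₁ a₂ e₁ e₂ (List.∷-injectiveʳ eq))
firstReturn-unique h       (H ∷ a₁) (H ∷ a₂) e₁ e₂ eq = ≡.cong (H ∷_) (firstReturn-unique h a₁ a₂ e₁ e₂ (List.∷-injectiveʳ eq))
firstReturn-unique (suc h) (D ∷ a₁) (D ∷ a₂) e₁ e₂ eq = ≡.cong (D ∷_) (firstReturn-unique h a₁ a₂ e₁ e₂ (List.∷-injectiveʳ eq))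

bargraph-shape : ∀ u → isBargraph (U ∷ u) ≡ true → ∃ λ a → u ≡ a ++ [ D ] × endHeight 0 a ≡ just 0
bargraph-shape u isBg with initLast u
... | []       with () ← isBg
... | a ∷ʳ′ U with () ← ≡.trans (≡.sym (∧-left isBg)) (run-wrapU a)
... | a ∷ʳ′ H with () ← ≡.trans (≡.sym (∧-left isBg)) (run-wrapH a)
... | a ∷ʳ′ D = a , refl , returns⇒≡just0 _ (≡.trans (≡.sym (run-wrapD a)) (∧-left isBg))

private
  prefix-D : ∀ m w v → isPrefix (replicate m H ++ [ D ]) (w ++ D ∷ v) ≡ isPrefix (replicate m H ++ [ D ]) (w ++ [ D ])
  prefix-D zero    []      v = refl
  prefix-D zero    (x ∷ w) v = refl
  prefix-D (suc m) []      v = refl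
  prefix-D (suc m) (x ∷ w) v = ≡.cong (eqStep H x ∧_) (prefix-D m w v)

peaks-split : ∀ ℓ w v → peaks ℓ (w ++ D ∷ v) ≡ peaks ℓ (w ++ [ D ]) + peaks ℓ v
peaks-split ℓ []      v = refl
peaks-split ℓ (x ∷ w) v = ≡.trans (≡.cong₂ _+_ (isPeak-D x) (peaks-split ℓ w v))
                                  (≡.sym (ℕ.+-assoc _ (peaks ℓ (w ++ [ D ])) (peaks ℓ v)))
  where
  isPeak-D : ∀ x → (if isPrefix (U ∷ replicate ℓ H ++ [ D ]) (x ∷ w ++ D ∷ v) then 1 else 0)
                 ≡ (if isPrefix (U ∷ replicate ℓ H ++ [ D ]) (x ∷ w ++ [ D ]) then 1 else 0)
  isPeak-D U = ≡.cong (λ b → if b then 1 else 0) (prefix-D ℓ w v)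
  isPeak-D H = refl
  isPeak-D D = refl

flat-peak : ∀ m → isPrefix (replicate m H ++ [ D ]) (replicate m H ++ [ D ]) ≡ true
flat-peak zero    = refl
flat-peak (suc m) = flat-peak m

peak⇒flat : ∀ m s → endHeight 0 s ≡ just 0 → isPrefix (replicate m H ++ [ D ]) (s ++ [ D ]) ≡ true → s ≡ replicate m H
peak⇒flat zero    []      _  _ = refl
peak⇒flat zero    (U ∷ s) _  ()
peak⇒flat zero    (H ∷ s) _  ()
peak⇒flat (suc m) (H ∷ s) eq p = ≡.cong (H ∷_) (peak⇒flat m s eq p)

peaks-flat : ∀ ℓ m → peaks ℓ (replicate m H ++ [ D ]) ≡ 0
peaks-flat ℓ zero    = refl
peaks-flat ℓ (suc m) = peaks-flat ℓ m

private
  count-balance : ∀ h w {h′} → endHeight h w ≡ just h′ → #U w + h ≡ count D w + h′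
  count-balance h       []      refl = refl
  count-balance h       (U ∷ w) eq   = ≡.trans (≡.sym (ℕ.+-suc (#U w) h)) (count-balance (suc h) w eq)
  count-balance h       (H ∷ w) eq   = count-balance h w eq
  count-balance (suc h) (D ∷ w) eq   = ≡.trans (ℕ.+-suc (#U w) h) (≡.cong suc (count-balance h w eq))

  length-count : ∀ w → length w ≡ #U w + #H w + count D w
  length-count []      = refl
  length-count (U ∷ w) = ≡.cong suc (length-count w)
  length-count (H ∷ w) = ≡.trans (≡.cong suc (length-count w)) (≡.cong (_+ count D w) (≡.sym (ℕ.+-suc (#U w) (#H w))))
  length-count (D ∷ w) = ≡.trans (≡.cong suc (length-count w)) (≡.sym (ℕ.+-suc (#U w + #H w) (count D w)))

balance : ∀ w → endHeight 0 w ≡ just 0 → #H w + 2 * #U w ≡ length w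
balance w eq = ≡.trans (rearrange (#U w) (#H w) (count D w) (≡.trans (≡.sym (ℕ.+-identityʳ _)) (≡.trans (count-balance 0 w eq) (ℕ.+-identityʳ _))))
                       (≡.sym (length-count w))
  where
  rearrange : ∀ u h d → u ≡ d → h + 2 * u ≡ u + h + d
  rearrange u h .u refl = lemma u h
    where
    open import Data.Nat.Tactic.RingSolver
    lemma : ∀ u h → h + 2 * u ≡ u + h + u
    lemma = solve-∀

private
  endHeight-flat : ∀ h m → endHeight h (replicate m H) ≡ just h
  endHeight-flat h zero    = refl
  endHeight-flat h (suc m) = endHeight-flat h m

  noUDDU-flat : ∀ m → noUDDU (replicate m H) ≡ true
  noUDDU-flat zero    = refl
  noUDDU-flat (suc m) = noUDDU-flat m

interior-flat : ∀ n → 1 ℕ.≤ n → interior (replicate n H) ≡ true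
interior-flat (suc m) _ rewrite endHeight-flat 0 m | noUDDU-flat m = refl

count-∷ʳD : ∀ x → x ≢ D → ∀ a → count x (a ++ [ D ]) ≡ count x a
count-∷ʳD U _ a = ≡.trans (count-++ U a [ D ]) (ℕ.+-identityʳ _)
count-∷ʳD H _ a = ≡.trans (count-++ H a [ D ]) (ℕ.+-identityʳ _)
count-∷ʳD D D≢D a with () ← D≢D refl

count-flat : ∀ x m → count x (replicate m H) ≡ (if eqStep x H then m else 0)
count-flat U zero    = refl
count-flat U (suc m) = count-flat U m
count-flat H zero    = refl
count-flat H (suc m) = ≡.cong suc (count-flat H m)
count-flat D zero    = refl
count-flat D (suc m) = count-flat D m

_≟ˢ_ : DecidableEquality Step
U ≟ˢ U = yes refl
U ≟ˢ H = no λ ()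
U ≟ˢ D = no λ ()
H ≟ˢ U = no λ ()
H ≟ˢ H = yes refl
H ≟ˢ D = no λ ()
D ≟ˢ U = no λ ()
D ≟ˢ H = no λ ()
D ≟ˢ D = yes refl

_≟ʷ_ : DecidableEquality (List Step)
_≟ʷ_ = List.≡-dec _≟ˢ_

data Monomial : Set where
  t^_x^_y^_ : ℕ → ℕ → ℕ → Monomial

infixl 7 _·_

_·_ : Maybe Monomial → Maybe Monomial → Maybe Monomial
just (t^ a x^ b y^ c) · just (t^ a′ x^ b′ y^ c′) = just (t^ (a + a′) x^ (b + b′) y^ (c + c′))
just _               · nothing                   = nothing
nothing              · _                         = nothing

monomial-cong : ∀ {a a′ b b′ c c′} → a ≡ a′ → b ≡ b′ → c ≡ c′ → t^ a x^ b y^ c ≡ t^ a′ x^ b′ y^ c′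
monomial-cong refl refl refl = refl

when : Bool → Monomial → Maybe Monomial
when b m = if b then just m else nothing

when-· : ∀ p q a b c a′ b′ c′ → when p (t^ a x^ b y^ c) · when q (t^ a′ x^ b′ y^ c′)
                               ≡ when (p ∧ q) (t^ (a + a′) x^ (b + b′) y^ (c + c′))
when-· true  true  _ _ _ _ _ _ = refl
when-· true  false _ _ _ _ _ _ = refl
when-· false q     _ _ _ _ _ _ = refl

𝐱ᵐ : Maybe Monomial
𝐱ᵐ = just (t^ 0 x^ 1 y^ 0)

𝐱·when : ∀ p a b c → 𝐱ᵐ · when p (t^ a x^ b y^ c) ≡ when p (t^ a x^ suc b y^ c)
𝐱·when true  a b c = refl
𝐱·when false a b c = refl

MonomialWeight : Set
MonomialWeight = List Step → Maybe Monomial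

Graded : MonomialWeight → Set
Graded f = ∀ w {a b c} → f w ≡ just (t^ a x^ b y^ c) → b + 2 * c ≡ length w

empty : MonomialWeight
empty []      = just (t^ 0 x^ 0 y^ 0)
empty (_ ∷ _) = nothing

letterH : MonomialWeight
letterH (H ∷ []) = 𝐱ᵐ
letterH _        = nothing

graded-empty : Graded empty
graded-empty [] refl = refl

graded-letterH : Graded letterH
graded-letterH (H ∷ []) refl = refl

𝐲ᵐ : Maybe Monomial
𝐲ᵐ = just (t^ 0 x^ 0 y^ 1)

𝐲·when : ∀ p a b c → 𝐲ᵐ · when p (t^ a x^ b y^ c) ≡ when p (t^ a x^ b y^ suc c)
𝐲·when true  a b c = refl
𝐲·when false a b c = refl

module Weights (ℓ : ℕ) where

  bargraph : MonomialWeight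
  bargraph w = when (isBargraph w) (t^ peaks ℓ w x^ #H w y^ #U w)

  -- the part of a bargraph strictly between its first and last step; its peaks are counted in s ++ [ D ]
  inner : MonomialWeight
  inner s = when (interior s) (t^ peaks ℓ (s ++ [ D ]) x^ #H s y^ #U s)

  emptyOrInner : MonomialWeight
  emptyOrInner []      = just (t^ 0 x^ 0 y^ 0)
  emptyOrInner (x ∷ s) = inner (x ∷ s)

  -- what follows the first return to height 1 inside an interior: empty, or H followed by emptyOrInner
  tail : MonomialWeight
  tail []      = just (t^ 0 x^ 0 y^ 0)
  tail (H ∷ v) = 𝐱ᵐ · emptyOrInner v
  tail (U ∷ v) = nothing
  tail (D ∷ v) = nothing

  inner-H : ∀ s → inner (H ∷ s) ≡ 𝐱ᵐ · emptyOrInner s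
  inner-H []      = refl
  inner-H (x ∷ s) = ≡.sym (𝐱·when (interior (x ∷ s)) _ _ _)

  tail-returning : ∀ b → endHeight 0 b ≡ just 0 → tail b ≡ when (noUDDU (D ∷ b)) (t^ peaks ℓ (b ++ [ D ]) x^ #H b y^ #U b)
  tail-returning []          _  = refl
  tail-returning (U ∷ b)     _  = refl
  tail-returning (H ∷ [])    _  = refl
  tail-returning (H ∷ x ∷ s) eq rewrite eq = 𝐱·when (noUDDU (x ∷ s)) _ _ _

  bargraph-wrap : ∀ a → endHeight 0 a ≡ just 0 →
    bargraph (U ∷ a ++ [ D ]) ≡ when (noUDDU (U ∷ a ++ [ D ])) (t^ peaks ℓ (U ∷ a ++ [ D ]) x^ #H (U ∷ a ++ [ D ]) y^ #U (U ∷ a ++ [ D ]))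
  bargraph-wrap a eq rewrite run-wrapD a | eq = refl

  inner-firstReturn : ∀ a b → endHeight 0 a ≡ just 0 → endHeight 0 b ≡ just 0 →
                      inner ((U ∷ a ++ [ D ]) ++ b) ≡ bargraph (U ∷ a ++ [ D ]) · tail b
  inner-firstReturn a b ea eb = begin
    inner ((U ∷ a ++ [ D ]) ++ b)
      ≡⟨ ≡.cong inner (List.++-assoc (U ∷ a) [ D ] b) ⟩
    inner (U ∷ a ++ D ∷ b)
      ≡⟨ ≡.cong₂ when (≡.cong₂ _∧_ (≡.cong returns (≡.trans (wrap-returns a b ea) eb)) (noUDDU-split (U ∷ a) b))
                      (monomial-cong peaks≡ (count-split H) (count-split U)) ⟩
    when (noUDDU (U ∷ a ++ [ D ]) ∧ noUDDU (D ∷ b))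
         (t^ peaks ℓ (U ∷ a ++ [ D ]) + peaks ℓ (b ++ [ D ]) x^ #H (U ∷ a ++ [ D ]) + #H b y^ (#U (U ∷ a ++ [ D ]) + #U b))
      ≡⟨ when-· _ _ _ _ _ _ _ _ ⟨
    when (noUDDU (U ∷ a ++ [ D ])) _ · when (noUDDU (D ∷ b)) _
      ≡⟨ ≡.cong₂ _·_ (bargraph-wrap a ea) (tail-returning b eb) ⟨
    bargraph (U ∷ a ++ [ D ]) · tail b ∎
    where
    open ≡.≡-Reasoning
    peaks≡ : peaks ℓ ((U ∷ a ++ D ∷ b) ++ [ D ]) ≡ peaks ℓ (U ∷ a ++ [ D ]) + peaks ℓ (b ++ [ D ])
    peaks≡ = ≡.trans (≡.cong (peaks ℓ) (List.++-assoc (U ∷ a) (D ∷ b) [ D ])) (peaks-split ℓ (U ∷ a) (b ++ [ D ]))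
    count-split : ∀ x → count x (U ∷ a ++ D ∷ b) ≡ count x (U ∷ a ++ [ D ]) + count x b
    count-split x = ≡.trans (≡.cong (count x) (≡.sym (List.++-assoc (U ∷ a) [ D ] b))) (count-++ x (U ∷ a ++ [ D ]) b)

  interior⇒returns : ∀ s → interior s ≡ true → endHeight 0 s ≡ just 0
  interior⇒returns (x ∷ s) eq = returns⇒≡just0 _ (∧-left eq)

  private
    when-just : ∀ b {m m′} → when b m ≡ just m′ → b ≡ true
    when-just true _ = refl

    inner-returns : ∀ s {m} → inner s ≡ just m → endHeight 0 s ≡ just 0
    inner-returns s eq = interior⇒returns s (when-just (interior s) eq)

    tail-returns : ∀ v {m} → tail v ≡ just m → endHeight 0 v ≡ just 0
    tail-returns []          _  = refl
    tail-returns (H ∷ [])    _  = refl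
    tail-returns (H ∷ x ∷ s) eq with inner (x ∷ s) in eq′
    ... | just _ = inner-returns (x ∷ s) eq′

  firstReturn-only : ∀ a b → endHeight 0 a ≡ just 0 → ∀ u v → u ++ v ≡ (U ∷ a ++ [ D ]) ++ b → u ≢ U ∷ a ++ [ D ] →
                     bargraph u · tail v ≡ nothing
  firstReturn-only a b ea []      v eq u≢ = refl
  firstReturn-only a b ea (H ∷ u) v eq u≢ = refl
  firstReturn-only a b ea (D ∷ u) v eq u≢ = refl
  firstReturn-only a b ea (U ∷ u) v eq u≢ with isBargraph (U ∷ u) in isBg
  ... | false = refl
  ... | true with bargraph-shape u isBg
  ...   | a′ , refl , ea′ = ⊥-elim (u≢ (≡.cong (λ x → U ∷ x ++ [ D ]) (firstReturn-unique 0 a′ a ea′ ea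
                             (≡.trans (≡.sym (List.++-assoc a′ [ D ] v)) (≡.trans (List.∷-injectiveʳ eq) (List.++-assoc a [ D ] b))))))

  noFirstReturn : ∀ s → endHeight 1 s ≢ just 0 → ∀ u v → u ++ v ≡ U ∷ s → bargraph u · tail v ≡ nothing
  noFirstReturn s ¬ret []      v eq = refl
  noFirstReturn s ¬ret (H ∷ u) v eq = refl
  noFirstReturn s ¬ret (D ∷ u) v eq = refl
  noFirstReturn s ¬ret (U ∷ u) v eq with isBargraph (U ∷ u) in isBg
  ... | false = refl
  ... | true with bargraph-shape u isBg | tail v in tv
  ...   | a′ , refl , ea′ | nothing = refl
  ...   | a′ , refl , ea′ | just _  = ⊥-elim (¬ret (begin
          endHeight 1 s                   ≡⟨ ≡.cong (endHeight 1) (List.∷-injectiveʳ eq) ⟨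
          endHeight 1 ((a′ ++ [ D ]) ++ v) ≡⟨ ≡.cong (endHeight 1) (List.++-assoc a′ [ D ] v) ⟩
          endHeight 1 (a′ ++ D ∷ v)        ≡⟨ wrap-returns a′ v ea′ ⟩
          endHeight 0 v                    ≡⟨ tail-returns v tv ⟩
          just 0                           ∎))
    where open ≡.≡-Reasoning

  inner-noReturn : ∀ s → endHeight 1 s ≢ just 0 → inner (U ∷ s) ≡ nothing
  inner-noReturn s ¬ret = ≡.cong (λ b → when (b ∧ noUDDU (U ∷ s)) (t^ peaks ℓ ((U ∷ s) ++ [ D ]) x^ #H (U ∷ s) y^ #U (U ∷ s)))
                                 (¬returns (endHeight 1 s) ¬ret)
    where
    ¬returns : ∀ m → m ≢ just 0 → returns m ≡ false
    ¬returns (just zero)    m≢ with () ← m≢ refl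
    ¬returns (just (suc _)) _  = refl
    ¬returns nothing        _  = refl

  graded-inner : Graded inner
  graded-inner s eq with interior s in int
  ... | true with eq
  ...   | refl = balance s (interior⇒returns s int)

  graded-emptyOrInner : Graded emptyOrInner
  graded-emptyOrInner []      refl = refl
  graded-emptyOrInner (x ∷ s) eq   = graded-inner (x ∷ s) eq

  graded-tail : Graded tail
  graded-tail []      refl = refl
  graded-tail (H ∷ v) eq with emptyOrInner v in e
  ... | just (t^ a x^ b y^ c) with eq
  ...   | refl = ≡.cong suc (graded-emptyOrInner v e)

  graded-bargraph : Graded bargraph
  graded-bargraph (U ∷ u) eq with isBargraph (U ∷ u) in isBg
  ... | true with eq | bargraph-shape u isBg
  ...   | refl | a , refl , ea = begin
          #H (U ∷ a ++ [ D ]) + 2 * #U (U ∷ a ++ [ D ])   ≡⟨ ≡.cong₂ (λ h u → h + 2 * suc u) (count-∷ʳD H (λ ()) a) (count-∷ʳD U (λ ()) a) ⟩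
          #H a + 2 * suc (#U a)                           ≡⟨ lemma (#H a) (#U a) ⟩
          suc (suc (#H a + 2 * #U a))                      ≡⟨ ≡.cong (suc ∘ suc) (balance a ea) ⟩
          suc (suc (length a))                             ≡⟨ ≡.cong suc (≡.trans (ℕ.+-comm 1 (length a)) (≡.sym (List.length-++ a))) ⟩
          length (U ∷ a ++ [ D ])                          ∎
    where
    open ≡.≡-Reasoning
    lemma : ∀ h u → h + 2 * suc u ≡ suc (suc (h + 2 * u))
    lemma = solve-∀ where open import Data.Nat.Tactic.RingSolver


  inner-flat : 1 ℕ.≤ ℓ → inner (replicate ℓ H) ≡ just (t^ 0 x^ ℓ y^ 0)
  inner-flat 1≤ℓ rewrite interior-flat ℓ 1≤ℓ | peaks-flat ℓ ℓ | count-flat H ℓ | count-flat U ℓ = refl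

  bargraph-flat : 1 ℕ.≤ ℓ → bargraph (U ∷ replicate ℓ H ++ [ D ]) ≡ just (t^ 1 x^ ℓ y^ 1)
  bargraph-flat 1≤ℓ rewrite isBargraph-wrap (replicate ℓ H) | interior-flat ℓ 1≤ℓ | flat-peak ℓ | peaks-flat ℓ ℓ
                          | count-∷ʳD H (λ ()) (replicate ℓ H) | count-∷ʳD U (λ ()) (replicate ℓ H) | count-flat H ℓ | count-flat U ℓ = refl

  bargraph-nonflat : ∀ s → s ≢ replicate ℓ H → bargraph (U ∷ s ++ [ D ]) ≡ 𝐲ᵐ · inner s
  bargraph-nonflat s s≢ rewrite isBargraph-wrap s | 𝐲·when (interior s) (peaks ℓ (s ++ [ D ])) (#H s) (#U s)
                              | count-∷ʳD H (λ ()) s | count-∷ʳD U (λ ()) s with interior s in int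
  ... | false = refl
  ... | true with isPrefix (replicate ℓ H ++ [ D ]) (s ++ [ D ]) in top
  ...   | false = refl
  ...   | true  = ⊥-elim (s≢ (peak⇒flat ℓ s (interior⇒returns s int) top))

  bargraph-∷ʳU : ∀ s → bargraph (U ∷ s ++ [ U ]) ≡ nothing
  bargraph-∷ʳU s rewrite run-wrapU s = refl

  bargraph-∷ʳH : ∀ s → bargraph (U ∷ s ++ [ H ]) ≡ nothing
  bargraph-∷ʳH s rewrite run-wrapH s = refl

ℤ-ring : CommutativeRing 0ℓ 0ℓ
ℤ-ring = ℤ.+-*-commutativeRing

module S₁ = PowerSeries ℤ-ring
module S₂ = PowerSeries S₁.series
module S₃ = PowerSeries S₂.series
open FiniteSums ℤ-ring using (∑; ∑-congˡ; ∑-cong; ∑-comm; ∑-single)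

sumTo≡∑ : ∀ n f → sumTo n f ≡ ∑ n f
sumTo≡∑ zero    f = ≡.refl
sumTo≡∑ (suc n) f = ≡.cong (ℤ._+ f (suc n)) (sumTo≡∑ n f)

⊗₂≡⊠ : ∀ F G i n → (F ⊗₂ G) i n ≡ (F S₂.⊠ G) i n
⊗₂≡⊠ F G i n = begin
  sumTo i (λ a → sumTo n (λ b → F a b ℤ.* G (i ∸ a) (n ∸ b)))
    ≡⟨ ≡.trans (sumTo≡∑ i _) (∑-congˡ i (λ a → sumTo≡∑ n _)) ⟩
  ∑ i (λ a → ∑ n (λ b → F a b ℤ.* G (i ∸ a) (n ∸ b)))
    ≡⟨ S₁.∑ₛ-apply i _ n ⟨
  (F S₂.⊠ G) i n ∎
  where open ≡.≡-Reasoning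

⊗≡∑ : ∀ F G i j k → (F ⊗ G) i j k ≡ ∑ i (λ a → ∑ j (λ b → ∑ k (λ c → F a b c ℤ.* G (i ∸ a) (j ∸ b) (k ∸ c))))
⊗≡∑ F G i j k = ≡.trans (sumTo≡∑ i _) (∑-congˡ i (λ a → ≡.trans (sumTo≡∑ j _) (∑-congˡ j (λ b → sumTo≡∑ k _))))

⊗≡⊠ : ∀ F G i j k → (F ⊗ G) i j k ≡ (F S₃.⊠ G) i j k
⊗≡⊠ F G i j k = begin
  (F ⊗ G) i j k
    ≡⟨ ⊗≡∑ F G i j k ⟩
  ∑ i (λ a → ∑ j (λ b → ∑ k (λ c → F a b c ℤ.* G (i ∸ a) (j ∸ b) (k ∸ c))))
    ≡⟨ ∑-congˡ i (λ a → S₁.∑ₛ-apply j _ k) ⟨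
  ∑ i (λ a → (F a S₂.⊠ G (i ∸ a)) j k)
    ≡⟨ ≡.trans (S₂.∑ₛ-apply i _ j k) (S₁.∑ₛ-apply i _ k) ⟨
  (F S₃.⊠ G) i j k ∎
  where open ≡.≡-Reasoning

-- The rings of the statement: their addition and multiplication are literally those of Defs, so that its
-- formulas are ring expressions.
ℙ₃ ℙ₂ : CommutativeRing 0ℓ 0ℓ
ℙ₃ = withOperations S₃.series _⊕_ _⊗_ (λ F G i j k → ≡.refl) (λ F G i j k → ⊗≡⊠ F G i j k)
ℙ₂ = withOperations S₂.series _⊕₂_ _⊗₂_ (λ F G i n → ≡.refl) (λ F G i n → ⊗₂≡⊠ F G i n)

module ℙ₃ = CommutativeRing ℙ₃
module ℙ₂ = CommutativeRing ℙ₂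

term≡monomial : ∀ n a b c i j k → term n a b c i j k ≡ S₃.monomial a (S₂.monomial b (S₁.monomial c n)) i j k
term≡monomial n a b c i j k with a ℕ.≡ᵇ i
... | false = ℤ.*-zeroʳ n
... | true with b ℕ.≡ᵇ j
...   | false = ℤ.*-zeroʳ n
...   | true with c ℕ.≡ᵇ k
...     | false = ℤ.*-zeroʳ n
...     | true  = ℤ.*-identityʳ n

term₂≡monomial : ∀ n a b i m → term₂ n a b i m ≡ S₂.monomial a (S₁.monomial b n) i m
term₂≡monomial n a b i m with a ℕ.≡ᵇ i
... | false = ℤ.*-zeroʳ n
... | true with b ℕ.≡ᵇ m
...   | false = ℤ.*-zeroʳ n
...   | true  = ℤ.*-identityʳ n

term-⊗ : ∀ m n a b c a′ b′ c′ → term m a b c ⊗ term n a′ b′ c′ ℙ₃.≈ term (m ℤ.* n) (a ℕ.+ a′) (b ℕ.+ b′) (c ℕ.+ c′)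
term-⊗ m n a b c a′ b′ c′ = begin
  term m a b c ⊗ term n a′ b′ c′
    ≈⟨ ⊗≡⊠ (term m a b c) (term n a′ b′ c′) ⟩
  term m a b c S₃.⊠ term n a′ b′ c′
    ≈⟨ S₃.⊠-cong (term≡monomial m a b c) (term≡monomial n a′ b′ c′) ⟩
  S₃.monomial a (S₂.monomial b (S₁.monomial c m)) S₃.⊠ S₃.monomial a′ (S₂.monomial b′ (S₁.monomial c′ n))
    ≈⟨ S₃.monomial-⊠-monomial a a′ _ _ ⟩
  S₃.monomial (a ℕ.+ a′) (S₂.monomial b (S₁.monomial c m) S₂.⊠ S₂.monomial b′ (S₁.monomial c′ n))
    ≈⟨ S₃.monomial-cong (a ℕ.+ a′) (ℙ₂.trans (S₂.monomial-⊠-monomial b b′ _ _)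
         (S₂.monomial-cong (b ℕ.+ b′) (S₁.monomial-⊠-monomial c c′ m n))) ⟩
  S₃.monomial (a ℕ.+ a′) (S₂.monomial (b ℕ.+ b′) (S₁.monomial (c ℕ.+ c′) (m ℤ.* n)))
    ≈⟨ ℙ₃.sym (term≡monomial (m ℤ.* n) (a ℕ.+ a′) (b ℕ.+ b′) (c ℕ.+ c′)) ⟩
  term (m ℤ.* n) (a ℕ.+ a′) (b ℕ.+ b′) (c ℕ.+ c′) ∎
  where open import Relation.Binary.Reasoning.Setoid ℙ₃.setoid

term₂-⊗ : ∀ m n a b a′ b′ → term₂ m a b ⊗₂ term₂ n a′ b′ ℙ₂.≈ term₂ (m ℤ.* n) (a ℕ.+ a′) (b ℕ.+ b′)
term₂-⊗ m n a b a′ b′ = begin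
  term₂ m a b ⊗₂ term₂ n a′ b′
    ≈⟨ ⊗₂≡⊠ (term₂ m a b) (term₂ n a′ b′) ⟩
  term₂ m a b S₂.⊠ term₂ n a′ b′
    ≈⟨ S₂.⊠-cong (term₂≡monomial m a b) (term₂≡monomial n a′ b′) ⟩
  S₂.monomial a (S₁.monomial b m) S₂.⊠ S₂.monomial a′ (S₁.monomial b′ n)
    ≈⟨ ℙ₂.trans (S₂.monomial-⊠-monomial a a′ _ _) (S₂.monomial-cong (a ℕ.+ a′) (S₁.monomial-⊠-monomial b b′ m n)) ⟩
  S₂.monomial (a ℕ.+ a′) (S₁.monomial (b ℕ.+ b′) (m ℤ.* n))
    ≈⟨ ℙ₂.sym (term₂≡monomial (m ℤ.* n) (a ℕ.+ a′) (b ℕ.+ b′)) ⟩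
  term₂ (m ℤ.* n) (a ℕ.+ a′) (b ℕ.+ b′) ∎
  where open import Relation.Binary.Reasoning.Setoid ℙ₂.setoid

term₂-⊕ : ∀ m n a b → term₂ m a b ⊕₂ term₂ n a b ℙ₂.≈ term₂ (m ℤ.+ n) a b
term₂-⊕ m n a b i k = ≡.sym (ℤ.*-distribʳ-+ (mono₂ a b i k) m n)

term-one : term (+ 1) 0 0 0 ℙ₃.≈ ℙ₃.1#
term-one zero    zero    zero    = ≡.refl
term-one zero    zero    (suc k) = ≡.refl
term-one zero    (suc j) k       = ≡.refl
term-one (suc i) j       k       = ≡.refl

term₂-one : term₂ (+ 1) 0 0 ℙ₂.≈ ℙ₂.1#
term₂-one zero    zero    = ≡.refl
term₂-one zero    (suc k) = ≡.refl
term₂-one (suc i) k       = ≡.refl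

module D = Diagonal ℤ-ring

diagonalize : PS3 → PS2
diagonalize F i = D.diagonal (F i)

Pzz≈diagonalizeP : ∀ ℓ → Pzz ℓ ℙ₂.≈ diagonalize (P ℓ)
Pzz≈diagonalizeP ℓ i n = sumTo≡∑ n _


open RingMorphisms ℙ₃.rawRing ℙ₂.rawRing using (IsRingHomomorphism)
module Σ₁ = FiniteSums S₁.series

diagonalize-term : ∀ n a b c → diagonalize (term n a b c) ℙ₂.≈ term₂ n a (b ℕ.+ c)
diagonalize-term n a b c i m = begin
  D.diagonal (term n a b c i) m
    ≡⟨ D.diagonal-cong (term≡monomial n a b c i) m ⟩
  D.diagonal (S₃.monomial a (S₂.monomial b (S₁.monomial c n)) i) m
    ≡⟨ diagonal-monomial (a ℕ.≡ᵇ i) ⟩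
  S₂.monomial a (S₁.monomial (b ℕ.+ c) n) i m
    ≡⟨ term₂≡monomial n a (b ℕ.+ c) i m ⟨
  term₂ n a (b ℕ.+ c) i m ∎
  where
  open ≡.≡-Reasoning
  diagonal-monomial : ∀ p → D.diagonal (if p then S₂.monomial b (S₁.monomial c n) else S₂.𝟘) m
                            ≡ (if p then S₁.monomial (b ℕ.+ c) n else S₁.𝟘) m
  diagonal-monomial true  = D.diagonal-monomial b c n m
  diagonal-monomial false = D.diagonal-𝟘 m

diagonalize-⊗ : ∀ F G → diagonalize (F ⊗ G) ℙ₂.≈ diagonalize F ⊗₂ diagonalize G
diagonalize-⊗ F G i = begin
  diagonalize (F ⊗ G) i
    ≈⟨ D.diagonal-cong (⊗≡⊠ F G i) ⟩
  D.diagonal (S₂.∑ₛ i (λ a → F a S₂.⊠ G (i ∸ a)))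
    ≈⟨ D.diagonal-∑ i _ ⟩
  S₁.∑ₛ i (λ a → D.diagonal (F a S₂.⊠ G (i ∸ a)))
    ≈⟨ Σ₁.∑-congˡ i (λ a → D.diagonal-⊠ (F a) (G (i ∸ a))) ⟩
  (diagonalize F S₂.⊠ diagonalize G) i
    ≈⟨ ⊗₂≡⊠ (diagonalize F) (diagonalize G) i ⟨
  (diagonalize F ⊗₂ diagonalize G) i ∎
  where open import Relation.Binary.Reasoning.Setoid (CommutativeRing.setoid S₁.series)

diagonalize-isRingHomomorphism : IsRingHomomorphism diagonalize
diagonalize-isRingHomomorphism = record
  { isSemiringHomomorphism = record
    { isNearSemiringHomomorphism = record
      { +-isMonoidHomomorphism = record
        { isMagmaHomomorphism = record
          { isRelHomomorphism = record { cong = λ F≈G i → D.diagonal-cong (F≈G i) }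
          ; homo = λ F G i → D.diagonal-⊞ (F i) (G i) }
        ; ε-homo = λ i → D.diagonal-𝟘 }
      ; *-homo = diagonalize-⊗ }
    ; 1#-homo = ℙ₂.trans (D.diagonal-cong ∘ ℙ₃.sym term-one) (ℙ₂.trans (diagonalize-term (+ 1) 0 0 0) term₂-one) }
  ; -‿homo = λ F i → D.diagonal-⊟ (F i) }

𝐭 𝐱 𝐲 : PS3
𝐭 = term (+ 1) 1 0 0
𝐱 = term (+ 1) 0 1 0
𝐲 = term (+ 1) 0 0 1

𝐱^_ : ℕ → PS3
𝐱^ n = term (+ 1) 0 n 0

𝐭₂ 𝐳 : PS2
𝐭₂ = term₂ (+ 1) 1 0
𝐳  = term₂ (+ 1) 0 1

𝐳^_ : ℕ → PS2
𝐳^ n = term₂ (+ 1) 0 n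

private
  𝐲-monomial : PS3
  𝐲-monomial = S₃.monomial 0 (S₂.monomial 0 (S₁.monomial 1 (+ 1)))

  𝐲⊗≡ : ∀ F i j k → (𝐲 ⊗ F) i j k ≡ (S₁.monomial 1 (+ 1) S₁.⊠ F i j) k
  𝐲⊗≡ F i j k = begin
    (𝐲 ⊗ F) i j k                                          ≡⟨ ⊗≡⊠ 𝐲 F i j k ⟩
    (𝐲 S₃.⊠ F) i j k                                       ≡⟨ S₃.⊠-cong (term≡monomial (+ 1) 0 0 1) (ℙ₃.refl {x = F}) i j k ⟩
    (𝐲-monomial S₃.⊠ F) i j k                              ≡⟨ S₃.monomial-⊠ 0 _ F i j k ⟩
    (S₂.monomial 0 (S₁.monomial 1 (+ 1)) S₂.⊠ F i) j k     ≡⟨ S₂.monomial-⊠ 0 _ (F i) j k ⟩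
    (S₁.monomial 1 (+ 1) S₁.⊠ F i j) k                     ∎
    where open ≡.≡-Reasoning

𝐲⊗-suc : ∀ F i j k → (𝐲 ⊗ F) i j (suc k) ≡ F i j k
𝐲⊗-suc F i j k = ≡.trans (𝐲⊗≡ F i j (suc k)) (≡.trans (S₁.monomial-⊠ 1 (+ 1) (F i j) k) (ℤ.*-identityˡ (F i j k)))

𝐲⊗-zero : ∀ F i j → (𝐲 ⊗ F) i j 0 ≡ + 0
𝐲⊗-zero F i j = ≡.trans (𝐲⊗≡ F i j 0) (S₁.monomial-⊠-below 1 (+ 1) (F i j) 0 (ℕ.s≤s ℕ.z≤n))

term-exponent : ∀ n a c {b b′} → b ≡ b′ → term n a b c ℙ₃.≈ term n a b′ c
term-exponent n a c ≡.refl i j k = ≡.refl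

𝐳^-cong : ∀ {m n} → m ≡ n → 𝐳^ m ℙ₂.≈ 𝐳^ n
𝐳^-cong ≡.refl i k = ≡.refl

𝐳^-+ : ∀ m n → 𝐳^ m ⊗₂ 𝐳^ n ℙ₂.≈ 𝐳^ (m ℕ.+ n)
𝐳^-+ m n = term₂-⊗ (+ 1) (+ 1) 0 m 0 n

-- Generating functions of weighted words

open WordSums ℙ₃

private
  module Wℤ = WordSums ℤ-ring
  module ∑₃ = FiniteSums ℙ₃

Homogeneous : Weight → Set
Homogeneous f = ∀ w i j k → j + 2 * k ≢ length w → f w i j k ≡ + 0

-- Only words of length j + 2k can contribute t^i x^j y^k to a homogeneous weight.
GF : Weight → PS3
GF f i j k = ∑ʷ (j + 2 * k) f i j k

∑ʷ-apply : ∀ n f i j k → ∑ʷ n f i j k ≡ Wℤ.∑ʷ n (λ w → f w i j k)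
∑ʷ-apply n f i j k = go (words n)
  where
  go : ∀ ws → ∑ˡ ws f i j k ≡ Wℤ.∑ˡ ws (λ w → f w i j k)
  go []       = ≡.refl
  go (w ∷ ws) = ≡.cong (ℤ._+_ (f w i j k)) (go ws)

∑-apply : ∀ n h i j k → ∑₃.∑ n h i j k ≡ ∑ n (λ a → h a i j k)
∑-apply zero    h i j k = ≡.refl
∑-apply (suc n) h i j k = ≡.cong (ℤ._+ h (suc n) i j k) (∑-apply n h i j k)

∑ʷ-homogeneous : ∀ {f} → Homogeneous f → ∀ a i j k → j + 2 * k ≢ a → ∑ʷ a f i j k ≡ + 0
∑ʷ-homogeneous {f} hom a i j k ≢a = ≡.trans (∑ʷ-apply a f i j k) (Wℤ.∑ʷ-vanish a (λ w |w|≡a → hom w i j k (λ eq → ≢a (≡.trans eq |w|≡a))))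

private
  totalDegree-∸ : ∀ {j₁ j k₁ k} → j₁ ≤ j → k₁ ≤ k → j + 2 * k ∸ (j₁ + 2 * k₁) ≡ (j ∸ j₁) + 2 * (k ∸ k₁)
  totalDegree-∸ {j₁} {j} {k₁} {k} j₁≤j k₁≤k = begin
    j + 2 * k ∸ (j₁ + 2 * k₁)
      ≡⟨ ≡.cong₂ (λ a b → a + 2 * b ∸ (j₁ + 2 * k₁)) (ℕ.m+[n∸m]≡n j₁≤j) (ℕ.m+[n∸m]≡n k₁≤k) ⟨
    j₁ + (j ∸ j₁) + 2 * (k₁ + (k ∸ k₁)) ∸ (j₁ + 2 * k₁)
      ≡⟨ ≡.cong (_∸ (j₁ + 2 * k₁)) (regroup j₁ (j ∸ j₁) k₁ (k ∸ k₁)) ⟩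
    j₁ + 2 * k₁ + ((j ∸ j₁) + 2 * (k ∸ k₁)) ∸ (j₁ + 2 * k₁)
      ≡⟨ ℕ.m+n∸m≡n (j₁ + 2 * k₁) _ ⟩
    (j ∸ j₁) + 2 * (k ∸ k₁) ∎
    where
    open ≡.≡-Reasoning
    regroup : ∀ a d b e → a + d + 2 * (b + e) ≡ a + 2 * b + (d + 2 * e)
    regroup = solve-∀ where open import Data.Nat.Tactic.RingSolver

GF-⋆ : ∀ {f g} → Homogeneous f → Homogeneous g → GF (f ⋆ g) ℙ₃.≈ GF f ⊗ GF g
GF-⋆ {f} {g} hom-f hom-g i j k = begin
  ∑ʷ N (f ⋆ g) i j k
    ≡⟨ ∑ʷ-⋆ N f g i j k ⟩
  ∑₃.∑ N (λ a → ∑ʷ a f ⊗ ∑ʷ (N ∸ a) g) i j k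
    ≡⟨ ≡.trans (∑-apply N _ i j k) (∑-congˡ N (λ a → ⊗≡∑ (∑ʷ a f) (∑ʷ (N ∸ a) g) i j k)) ⟩
  ∑ N (λ a → ∑ i (λ i₁ → ∑ j (λ j₁ → ∑ k (λ k₁ → summand a i₁ j₁ k₁))))
    ≡⟨ ≡.trans (∑-comm N i _) (∑-congˡ i (λ i₁ → ≡.trans (∑-comm N j _) (∑-congˡ j (λ j₁ → ∑-comm N k _)))) ⟩
  ∑ i (λ i₁ → ∑ j (λ j₁ → ∑ k (λ k₁ → ∑ N (λ a → summand a i₁ j₁ k₁))))
    ≡⟨ ∑-congˡ i (λ i₁ → ∑-cong j (λ j₁ j₁≤j → ∑-cong k (λ k₁ k₁≤k → collapse i₁ j₁≤j k₁≤k))) ⟩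
  ∑ i (λ i₁ → ∑ j (λ j₁ → ∑ k (λ k₁ → GF f i₁ j₁ k₁ ℤ.* GF g (i ∸ i₁) (j ∸ j₁) (k ∸ k₁))))
    ≡⟨ ⊗≡∑ (GF f) (GF g) i j k ⟨
  (GF f ⊗ GF g) i j k ∎
  where
  open ≡.≡-Reasoning
  N = j + 2 * k
  summand : ℕ → ℕ → ℕ → ℕ → ℤ
  summand a i₁ j₁ k₁ = ∑ʷ a f i₁ j₁ k₁ ℤ.* ∑ʷ (N ∸ a) g (i ∸ i₁) (j ∸ j₁) (k ∸ k₁)
  collapse : ∀ i₁ {j₁ k₁} → j₁ ≤ j → k₁ ≤ k → ∑ N (λ a → summand a i₁ j₁ k₁) ≡ GF f i₁ j₁ k₁ ℤ.* GF g (i ∸ i₁) (j ∸ j₁) (k ∸ k₁)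
  collapse i₁ {j₁} {k₁} j₁≤j k₁≤k = ≡.trans
    (∑-single N (j₁ + 2 * k₁) (ℕ.+-mono-≤ j₁≤j (ℕ.*-monoʳ-≤ 2 k₁≤k))
      (λ a _ a≢ → ≡.trans (≡.cong (ℤ._* ∑ʷ (N ∸ a) g (i ∸ i₁) (j ∸ j₁) (k ∸ k₁)) (∑ʷ-homogeneous hom-f a i₁ j₁ k₁ (a≢ ∘ ≡.sym))) (ℤ.*-zeroˡ (∑ʷ (N ∸ a) g (i ∸ i₁) (j ∸ j₁) (k ∸ k₁)))))
    (≡.cong (λ m → GF f i₁ j₁ k₁ ℤ.* ∑ʷ m g (i ∸ i₁) (j ∸ j₁) (k ∸ k₁)) (totalDegree-∸ j₁≤j k₁≤k))

GF-cong : ∀ {f g} → (∀ w → f w ℙ₃.≈ g w) → GF f ℙ₃.≈ GF g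
GF-cong f≈g i j k = ∑ʷ-cong (j + 2 * k) f≈g i j k

GF-+ : ∀ f g → GF (λ w → f w ⊕ g w) ℙ₃.≈ GF f ⊕ GF g
GF-+ f g i j k = ∑ʷ-+ (j + 2 * k) f g i j k

GF-single : ∀ v {f} → (∀ w → w ≢ v → f w ℙ₃.≈ ℙ₃.0#) → Homogeneous f → GF f ℙ₃.≈ f v
GF-single v {f} f≈0 hom i j k with j + 2 * k ℕ.≟ length v
... | yes eq rewrite eq = ∑ʷ-single v (λ w _ w≢v → f≈0 w w≢v) i j k
... | no ≢  = ≡.trans (∑ʷ-vanish (j + 2 * k) (λ w |w|≡ → f≈0 w (λ w≡v → ≢ (≡.trans (≡.sym |w|≡) (≡.cong length w≡v)))) i j k)
                      (≡.sym (hom v i j k ≢))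

-- The decomposition of bargraphs

open ℙ₃ using (_≈_)

⟦_⟧ : Maybe Monomial → PS3
⟦ nothing ⟧               = ℙ₃.0#
⟦ just (t^ a x^ b y^ c) ⟧ = term (+ 1) a b c

⟦·⟧ : ∀ m m′ → ⟦ m · m′ ⟧ ≈ ⟦ m ⟧ ⊗ ⟦ m′ ⟧
⟦·⟧ (just (t^ a x^ b y^ c)) (just (t^ a′ x^ b′ y^ c′)) = ℙ₃.sym (term-⊗ (+ 1) (+ 1) a b c a′ b′ c′)
⟦·⟧ (just (t^ a x^ b y^ c)) nothing = ℙ₃.sym (ℙ₃.zeroʳ (term (+ 1) a b c))
⟦·⟧ nothing m′ = ℙ₃.sym (ℙ₃.zeroˡ ⟦ m′ ⟧)

⟦_⟧ʷ : MonomialWeight → Weight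
⟦ f ⟧ʷ w = ⟦ f w ⟧

private
  ≡ᵇ⇒≡ : ∀ {m n} → (m ℕ.≡ᵇ n) ≡ true → m ≡ n
  ≡ᵇ⇒≡ {m} {n} eq = ℕ.≡ᵇ⇒≡ m n (≡.subst T (≡.sym eq) tt)

term-vanishes : ∀ a b c i j k → j + 2 * k ≢ b + 2 * c → term (+ 1) a b c i j k ≡ + 0
term-vanishes a b c i j k ≢ with a ℕ.≡ᵇ i
... | false = refl
... | true with b ℕ.≡ᵇ j in eb
...   | false = refl
...   | true with c ℕ.≡ᵇ k in ec
...     | false = refl
...     | true  = ⊥-elim (≢ (≡.cong₂ (λ j k → j + 2 * k) (≡.sym (≡ᵇ⇒≡ {b} {j} eb)) (≡.sym (≡ᵇ⇒≡ {c} {k} ec))))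

term-y0 : ∀ a b c i j → term (+ 1) a b (suc c) i j 0 ≡ + 0
term-y0 a b c i j with a ℕ.≡ᵇ i
... | false = refl
... | true with b ℕ.≡ᵇ j
...   | false = refl
...   | true  = refl

graded⇒homogeneous : ∀ {f} → Graded f → Homogeneous ⟦ f ⟧ʷ
graded⇒homogeneous {f} graded w i j k ≢ with f w in eq
... | nothing = refl
... | just (t^ a x^ b y^ c) = term-vanishes a b c i j k (λ eq′ → ≢ (≡.trans eq′ (graded w eq)))

⟦·⟧≈0 : ∀ m m′ → m · m′ ≡ nothing → ⟦ m ⟧ ⊗ ⟦ m′ ⟧ ≈ ℙ₃.0#
⟦·⟧≈0 m m′ eq = ℙ₃.trans (ℙ₃.sym (⟦·⟧ m m′)) (ℙ₃.reflexive (≡.cong ⟦_⟧ eq))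

GF-empty : GF ⟦ empty ⟧ʷ ≈ ℙ₃.1#
GF-empty = ℙ₃.trans (GF-single [] vanish (graded⇒homogeneous graded-empty)) term-one
  where
  vanish : ∀ w → w ≢ [] → ⟦ empty w ⟧ ≈ ℙ₃.0#
  vanish []      w≢ with () ← w≢ refl
  vanish (_ ∷ _) _  = ℙ₃.refl

GF-letterH : GF ⟦ letterH ⟧ʷ ≈ 𝐱
GF-letterH = GF-single [ H ] vanish (graded⇒homogeneous graded-letterH)
  where
  vanish : ∀ w → w ≢ [ H ] → ⟦ letterH w ⟧ ≈ ℙ₃.0#
  vanish []          _  = ℙ₃.refl
  vanish (U ∷ _)     _  = ℙ₃.refl
  vanish (H ∷ [])    w≢ with () ← w≢ refl
  vanish (H ∷ _ ∷ _) _  = ℙ₃.refl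
  vanish (D ∷ _)     _  = ℙ₃.refl

module BargraphSeries (ℓ : ℕ) where

  open Weights ℓ
  open ℙ₃ hiding (_≈_; refl; _+_; _*_)
  open import Relation.Binary.Reasoning.Setoid setoid

  private
    refl⟨_⟩ : ∀ F → F ≈ F
    refl⟨ F ⟩ = ℙ₃.refl {x = F}

  interiors : PS3
  interiors = GF ⟦ inner ⟧ʷ

  private
    L J K B : Weight
    L = ⟦ letterH ⟧ʷ
    J = ⟦ emptyOrInner ⟧ʷ
    K = ⟦ tail ⟧ʷ
    B = ⟦ bargraph ⟧ʷ

    L⋆J-H : ∀ s → (L ⋆ J) (H ∷ s) ≈ 𝐱 ⊗ J s
    L⋆J-H s = ⋆-single [ H ] s {L} {J} vanish
      where
      vanish : ∀ u v → u ++ v ≡ H ∷ s → u ≢ [ H ] → L u ⊗ J v ≈ 0#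
      vanish []          v _  _  = zeroˡ (J v)
      vanish (H ∷ [])    v _  u≢ with () ← u≢ refl
      vanish (H ∷ _ ∷ _) v _  _  = zeroˡ (J v)

    L⋆J-vanish : ∀ x s → x ≢ H → (L ⋆ J) (x ∷ s) ≈ 0#
    L⋆J-vanish x s x≢H = ⋆-vanish (x ∷ s) {L} {J} vanish
      where
      vanish : ∀ u v → u ++ v ≡ x ∷ s → L u ⊗ J v ≈ 0#
      vanish []          v _  = zeroˡ (J v)
      vanish (U ∷ _)     v _  = zeroˡ (J v)
      vanish (D ∷ _)     v _  = zeroˡ (J v)
      vanish (H ∷ [])    v eq with () ← x≢H (≡.sym (List.∷-injectiveˡ eq))
      vanish (H ∷ _ ∷ _) v _  = zeroˡ (J v)

    B⋆K-vanish : ∀ x s → x ≢ U → (B ⋆ K) (x ∷ s) ≈ 0#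
    B⋆K-vanish x s x≢U = ⋆-vanish (x ∷ s) {B} {K} vanish
      where
      vanish : ∀ u v → u ++ v ≡ x ∷ s → B u ⊗ K v ≈ 0#
      vanish []      v _  = zeroˡ (K v)
      vanish (H ∷ _) v _  = zeroˡ (K v)
      vanish (D ∷ _) v _  = zeroˡ (K v)
      vanish (U ∷ _) v eq with () ← x≢U (≡.sym (List.∷-injectiveˡ eq))

    reassociate : ∀ a b → (U ∷ a ++ [ D ]) ++ b ≡ U ∷ a ++ D ∷ b
    reassociate a b = ≡.cong (U ∷_) (List.++-assoc a [ D ] b)

    -- Transport along the word equations instead of matching on them: matching normalises the
    -- series-valued goal, which is prohibitively slow.
    inner-U : ∀ s → ⟦ inner (U ∷ s) ⟧ ≈ (B ⋆ K) (U ∷ s)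
    inner-U s = byFirstReturn (endHeight 1 s) refl
      where
      vanishing : endHeight 1 s ≢ just 0 → ⟦ inner (U ∷ s) ⟧ ≈ (B ⋆ K) (U ∷ s)
      vanishing ¬ret = trans (reflexive (≡.cong ⟦_⟧ (inner-noReturn s ¬ret)))
                             (sym (⋆-vanish (U ∷ s) {B} {K} (λ u v uv≡ → ⟦·⟧≈0 (bargraph u) (tail v) (noFirstReturn s ¬ret u v uv≡))))
      byFirstReturn : ∀ m → endHeight 1 s ≡ m → ⟦ inner (U ∷ s) ⟧ ≈ (B ⋆ K) (U ∷ s)
      byFirstReturn (just zero)    eq =
        let a , b , s≡ , ea , eb = firstReturn 0 0 s eq in
        ≡.subst (λ w → ⟦ inner w ⟧ ≈ (B ⋆ K) w) (≡.trans (reassociate a b) (≡.cong (U ∷_) (≡.sym s≡))) (begin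
          ⟦ inner ((U ∷ a ++ [ D ]) ++ b) ⟧            ≡⟨ ≡.cong ⟦_⟧ (inner-firstReturn a b ea eb) ⟩
          ⟦ bargraph (U ∷ a ++ [ D ]) · tail b ⟧      ≈⟨ ⟦·⟧ (bargraph (U ∷ a ++ [ D ])) (tail b) ⟩
          B (U ∷ a ++ [ D ]) ⊗ K b                     ≈⟨ ⋆-single (U ∷ a ++ [ D ]) b {B} {K}
                                                            (λ u v uv≡ u≢ → ⟦·⟧≈0 (bargraph u) (tail v) (firstReturn-only a b ea u v uv≡ u≢)) ⟨
          (B ⋆ K) ((U ∷ a ++ [ D ]) ++ b)             ∎)
      byFirstReturn (just (suc h)) eq = vanishing (λ eq′ → just-suc≢ (≡.trans (≡.sym eq) eq′))
        where
        just-suc≢ : just (suc h) ≢ just 0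
        just-suc≢ ()
      byFirstReturn nothing        eq = vanishing (λ eq′ → nothing≢ (≡.trans (≡.sym eq) eq′))
        where
        nothing≢ : nothing ≢ just 0
        nothing≢ ()

  inner-decomposition : ∀ w → ⟦ inner w ⟧ ≈ (L ⋆ J) w ⊕ (B ⋆ K) w
  inner-decomposition []      = sym (trans (+-cong (zeroˡ (J [])) (zeroˡ (K []))) (+-identityʳ 0#))
  inner-decomposition (U ∷ s) = trans (inner-U s) (sym (trans (+-cong (L⋆J-vanish U s λ ()) refl⟨ (B ⋆ K) (U ∷ s) ⟩) (+-identityˡ _)))
  inner-decomposition (H ∷ s) = begin
    ⟦ inner (H ∷ s) ⟧               ≡⟨ ≡.cong ⟦_⟧ (inner-H s) ⟩
    ⟦ 𝐱ᵐ · emptyOrInner s ⟧         ≈⟨ ⟦·⟧ 𝐱ᵐ (emptyOrInner s) ⟩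
    𝐱 ⊗ J s                         ≈⟨ L⋆J-H s ⟨
    (L ⋆ J) (H ∷ s)                 ≈⟨ +-identityʳ _ ⟨
    (L ⋆ J) (H ∷ s) ⊕ 0#            ≈⟨ +-cong refl⟨ (L ⋆ J) (H ∷ s) ⟩ (B⋆K-vanish H s λ ()) ⟨
    (L ⋆ J) (H ∷ s) ⊕ (B ⋆ K) (H ∷ s) ∎
  inner-decomposition (D ∷ s) = sym (trans (+-cong (L⋆J-vanish D s λ ()) (B⋆K-vanish D s λ ())) (+-identityʳ 0#))

  emptyOrInner-decomposition : ∀ w → J w ≈ ⟦ empty w ⟧ ⊕ ⟦ inner w ⟧
  emptyOrInner-decomposition []      = sym (+-identityʳ _)
  emptyOrInner-decomposition (x ∷ s) = sym (+-identityˡ _)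

  tail-decomposition : ∀ w → K w ≈ ⟦ empty w ⟧ ⊕ (L ⋆ J) w
  tail-decomposition []      = sym (trans (+-cong refl⟨ ⟦ empty [] ⟧ ⟩ (zeroˡ (J []))) (+-identityʳ _))
  tail-decomposition (U ∷ v) = sym (trans (+-cong refl⟨ 0# ⟩ (L⋆J-vanish U v λ ())) (+-identityʳ 0#))
  tail-decomposition (H ∷ v) = trans (⟦·⟧ 𝐱ᵐ (emptyOrInner v)) (trans (sym (L⋆J-H v)) (sym (+-identityˡ _)))
  tail-decomposition (D ∷ v) = sym (trans (+-cong refl⟨ 0# ⟩ (L⋆J-vanish D v λ ())) (+-identityʳ 0#))

  GF-emptyOrInner : GF J ≈ 1# ⊕ interiors
  GF-emptyOrInner = trans (GF-cong emptyOrInner-decomposition)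
                          (trans (GF-+ ⟦ empty ⟧ʷ ⟦ inner ⟧ʷ) (+-cong GF-empty refl⟨ interiors ⟩))

  GF-L⋆J : GF (L ⋆ J) ≈ 𝐱 ⊗ (1# ⊕ interiors)
  GF-L⋆J = trans (GF-⋆ (graded⇒homogeneous graded-letterH) (graded⇒homogeneous graded-emptyOrInner))
                 (*-cong GF-letterH GF-emptyOrInner)

  GF-tail : GF K ≈ 1# ⊕ 𝐱 ⊗ (1# ⊕ interiors)
  GF-tail = trans (GF-cong tail-decomposition) (trans (GF-+ ⟦ empty ⟧ʷ (L ⋆ J)) (+-cong GF-empty GF-L⋆J))

  P≈GF : P ℓ ≈ GF B
  P≈GF i j k = ≡.trans (count-filter (words (j + 2 * k))) (≡.sym (≡.trans (∑ʷ-apply (j + 2 * k) B i j k)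
                 (Wℤ.∑ˡ-cong (words (j + 2 * k)) bargraph-coefficient)))
    where
    selected? : List Step → Bool
    selected? = selected ℓ i j k
    count-filter : ∀ ws → + length (filter (λ w → selected? w ≟ᵇ true) ws) ≡ Wℤ.∑ˡ ws (λ w → if selected? w then + 1 else + 0)
    count-filter []       = refl
    count-filter (w ∷ ws) with selected? w
    ... | true  = ≡.cong (ℤ._+_ (+ 1)) (count-filter ws)
    ... | false = ≡.trans (count-filter ws) (≡.sym (ℤ.+-identityˡ _))
    bargraph-coefficient : ∀ w → B w i j k ≡ (if selected? w then + 1 else + 0)
    bargraph-coefficient w with isBargraph w
    ... | true  = ℤ.*-identityˡ _
    ... | false = refl

  interiors-equation : interiors ≈ 𝐱 ⊗ (1# ⊕ interiors) ⊕ P ℓ ⊗ (1# ⊕ 𝐱 ⊗ (1# ⊕ interiors))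
  interiors-equation = begin
    interiors                                   ≈⟨ GF-cong inner-decomposition ⟩
    GF (λ w → (L ⋆ J) w ⊕ (B ⋆ K) w)            ≈⟨ GF-+ (L ⋆ J) (B ⋆ K) ⟩
    GF (L ⋆ J) ⊕ GF (B ⋆ K)                     ≈⟨ +-cong GF-L⋆J (GF-⋆ (graded⇒homogeneous graded-bargraph) (graded⇒homogeneous graded-tail)) ⟩
    𝐱 ⊗ (1# ⊕ interiors) ⊕ GF B ⊗ GF K          ≈⟨ +-cong refl⟨ 𝐱 ⊗ (1# ⊕ interiors) ⟩ (*-cong (sym P≈GF) GF-tail) ⟩
    𝐱 ⊗ (1# ⊕ interiors) ⊕ P ℓ ⊗ (1# ⊕ 𝐱 ⊗ (1# ⊕ interiors)) ∎

  private
    flat : List Step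
    flat = replicate ℓ H

  correction : PS3
  correction = (𝐭 - 1#) ⊗ 𝐱^ ℓ ⊗ 𝐲

  private
    module I = IntegerCoefficients ℙ₃

    correction-terms : correction ≈ term (+ 1) 1 ℓ 1 ⊖ term (+ 1) 0 ℓ 1
    correction-terms = trans (I.solve 3 (λ t w y → (t I.:- I.con (+ 1)) I.:* w I.:* y I.:= t I.:* w I.:* y I.:- w I.:* y) ℙ₃.refl 𝐭 (𝐱^ ℓ) 𝐲)
                        (+-cong twy (-‿cong wy))
      where
      twy : 𝐭 ⊗ 𝐱^ ℓ ⊗ 𝐲 ≈ term (+ 1) 1 ℓ 1
      twy = trans (*-cong (term-⊗ (+ 1) (+ 1) 1 0 0 0 ℓ 0) refl⟨ 𝐲 ⟩)
                  (trans (term-⊗ (+ 1) (+ 1) 1 ℓ 0 0 0 1) (term-exponent (+ 1) 1 1 (ℕ.+-identityʳ ℓ)))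
      wy : 𝐱^ ℓ ⊗ 𝐲 ≈ term (+ 1) 0 ℓ 1
      wy = trans (term-⊗ (+ 1) (+ 1) 0 ℓ 0 0 0 1) (term-exponent (+ 1) 0 1 (ℕ.+-identityʳ ℓ))

    correctionOf : ∀ {s} → Dec (s ≡ flat) → PS3
    correctionOf (yes _) = correction
    correctionOf (no _)  = 0#

  correctionWeight : Weight
  correctionWeight s = correctionOf (s ≟ʷ flat)

  private
    correctionOf-vanishes : ∀ {s} (d : Dec (s ≡ flat)) → s ≢ flat → correctionOf d ≈ 0#
    correctionOf-vanishes (yes s≡) s≢ with () ← s≢ s≡
    correctionOf-vanishes (no _)   _  = ℙ₃.refl

    correctionOf-flat : (d : Dec (flat ≡ flat)) → correctionOf d ≈ correction
    correctionOf-flat (yes _) = ℙ₃.refl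
    correctionOf-flat (no ¬p) with () ← ¬p refl

    ∑ʷ-correction-ℓ : ∑ʷ ℓ correctionWeight ≈ correction
    ∑ʷ-correction-ℓ = ≡.subst (λ n → ∑ʷ n correctionWeight ≈ correction) (List.length-replicate ℓ)
                        (trans (∑ʷ-single flat (λ w _ w≢ → correctionOf-vanishes (w ≟ʷ flat) w≢)) (correctionOf-flat (flat ≟ʷ flat)))

    ∑ʷ-correction-≢ : ∀ {n} → n ≢ ℓ → ∑ʷ n correctionWeight ≈ 0#
    ∑ʷ-correction-≢ {n} n≢ℓ = ∑ʷ-vanish n (λ w |w|≡n → correctionOf-vanishes (w ≟ʷ flat)
                                (λ w≡ → n≢ℓ (≡.trans (≡.sym |w|≡n) (≡.trans (≡.cong length w≡) (List.length-replicate ℓ)))))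

    correction-coefficient : ∀ i j k → Dec (j + 2 * k ≡ ℓ) → ∑ʷ (j + 2 * k) correctionWeight i j (suc k) ≡ correction i j (suc k)
    correction-coefficient i j k (yes eq) = ≡.subst (λ n → ∑ʷ n correctionWeight i j (suc k) ≡ correction i j (suc k)) (≡.sym eq)
                                              (∑ʷ-correction-ℓ i j (suc k))
    correction-coefficient i j k (no ne)  = ≡.trans (∑ʷ-correction-≢ ne i j (suc k)) (≡.sym (≡.trans (correction-terms i j (suc k))
                                              (≡.cong₂ (λ a b → a ℤ.+ ℤ.- b) (term-vanishes 1 ℓ 1 i j (suc k) ne′) (term-vanishes 0 ℓ 1 i j (suc k) ne′))))
      where
      ne′ : j + 2 * suc k ≢ ℓ + 2 * 1
      ne′ eq = ne (ℕ.+-cancelʳ-≡ 2 (j + 2 * k) ℓ (≡.trans (shift j k) eq))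
        where
        shift : ∀ j k → j + 2 * k + 2 ≡ j + 2 * suc k
        shift = solve-∀ where open import Data.Nat.Tactic.RingSolver

    correction-y0 : ∀ i j → correction i j 0 ≡ + 0
    correction-y0 i j = ≡.trans (correction-terms i j 0) (≡.cong₂ (λ a b → a ℤ.+ ℤ.- b) (term-y0 1 ℓ 0 i j) (term-y0 0 ℓ 0 i j))

    bargraph-y0 : ∀ w i j → B w i j 0 ≡ + 0
    bargraph-y0 []      i j = refl
    bargraph-y0 (H ∷ _) i j = refl
    bargraph-y0 (D ∷ _) i j = refl
    bargraph-y0 (U ∷ u) i j with isBargraph (U ∷ u)
    ... | true  = term-y0 (peaks ℓ (U ∷ u)) (#H (U ∷ u)) (#U u) i j
    ... | false = refl

  module _ (1≤ℓ : 1 ℕ.≤ ℓ) where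

    private
      wrap : ∀ s (d : Dec (s ≡ flat)) → B (U ∷ s ++ [ D ]) ≈ 𝐲 ⊗ ⟦ inner s ⟧ ⊕ correctionOf d
      wrap s (no s≢) = trans (reflexive (≡.cong ⟦_⟧ (bargraph-nonflat s s≢)))
                             (trans (⟦·⟧ 𝐲ᵐ (inner s)) (sym (+-identityʳ _)))
      wrap .flat (yes refl) = begin
        B (U ∷ flat ++ [ D ])                            ≡⟨ ≡.cong ⟦_⟧ (bargraph-flat 1≤ℓ) ⟩
        term (+ 1) 1 ℓ 1                                 ≈⟨ I.solve 2 (λ a b → b I.:= a I.:+ (b I.:- a)) ℙ₃.refl (term (+ 1) 0 ℓ 1) (term (+ 1) 1 ℓ 1) ⟩
        term (+ 1) 0 ℓ 1 ⊕ (term (+ 1) 1 ℓ 1 ⊖ term (+ 1) 0 ℓ 1)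
          ≈⟨ +-cong (term-⊗ (+ 1) (+ 1) 0 0 1 0 ℓ 0) correction-terms ⟨
        𝐲 ⊗ 𝐱^ ℓ ⊕ correction                           ≡⟨ ≡.cong (λ m → 𝐲 ⊗ ⟦ m ⟧ ⊕ correction) (inner-flat 1≤ℓ) ⟨
        𝐲 ⊗ ⟦ inner flat ⟧ ⊕ correction                  ∎

    bargraph-wrap≈ : ∀ s → B (U ∷ s ++ [ D ]) ≈ 𝐲 ⊗ ⟦ inner s ⟧ ⊕ correctionWeight s
    bargraph-wrap≈ s = wrap s (s ≟ʷ flat)

    ∑ʷ-bargraphs : ∀ n → ∑ʷ (suc (suc n)) B ≈ 𝐲 ⊗ ∑ʷ n ⟦ inner ⟧ʷ ⊕ ∑ʷ n correctionWeight
    ∑ʷ-bargraphs n = begin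
      ∑ʷ (suc (suc n)) B
        ≈⟨ ∑ʷ-∷ (suc n) B ⟩
      ∑ʷ (suc n) (λ w → B (U ∷ w)) ⊕ ∑ʷ (suc n) (λ w → B (H ∷ w)) ⊕ ∑ʷ (suc n) (λ w → B (D ∷ w))
        ≈⟨ trans (+-cong (+-cong refl⟨ ∑ʷ (suc n) (λ w → B (U ∷ w)) ⟩ (∑ʷ-vanish (suc n) (λ _ _ → ℙ₃.refl)))
                         (∑ʷ-vanish (suc n) (λ _ _ → ℙ₃.refl)))
                 (trans (+-identityʳ _) (+-identityʳ _)) ⟩
      ∑ʷ (suc n) (λ w → B (U ∷ w))
        ≈⟨ ∑ʷ-∷ʳ n (λ w → B (U ∷ w)) ⟩
      ∑ʷ n (λ s → B (U ∷ s ++ [ U ])) ⊕ ∑ʷ n (λ s → B (U ∷ s ++ [ H ])) ⊕ ∑ʷ n (λ s → B (U ∷ s ++ [ D ]))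
        ≈⟨ trans (+-cong (+-cong (∑ʷ-vanish n (λ s _ → reflexive (≡.cong ⟦_⟧ (bargraph-∷ʳU s))))
                                 (∑ʷ-vanish n (λ s _ → reflexive (≡.cong ⟦_⟧ (bargraph-∷ʳH s)))))
                         refl⟨ ∑ʷ n (λ s → B (U ∷ s ++ [ D ])) ⟩)
                 (trans (+-cong (+-identityʳ 0#) refl⟨ ∑ʷ n (λ s → B (U ∷ s ++ [ D ])) ⟩) (+-identityˡ _)) ⟩
      ∑ʷ n (λ s → B (U ∷ s ++ [ D ]))
        ≈⟨ ∑ʷ-cong n bargraph-wrap≈ ⟩
      ∑ʷ n (λ s → 𝐲 ⊗ ⟦ inner s ⟧ ⊕ correctionWeight s)
        ≈⟨ ∑ʷ-+ n (λ s → 𝐲 ⊗ ⟦ inner s ⟧) correctionWeight ⟩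
      ∑ʷ n (λ s → 𝐲 ⊗ ⟦ inner s ⟧) ⊕ ∑ʷ n correctionWeight
        ≈⟨ +-cong (*-∑ʷ n 𝐲 ⟦ inner ⟧ʷ) refl⟨ ∑ʷ n correctionWeight ⟩ ⟨
      𝐲 ⊗ ∑ʷ n ⟦ inner ⟧ʷ ⊕ ∑ʷ n correctionWeight ∎

    GF-bargraphs : GF B ≈ 𝐲 ⊗ interiors ⊕ correction
    GF-bargraphs i j zero    = ≡.trans (∑ʷ-apply (j + 2 * 0) B i j 0)
                                 (≡.trans (Wℤ.∑ʷ-vanish (j + 2 * 0) (λ w _ → bargraph-y0 w i j))
                                 (≡.sym (≡.cong₂ ℤ._+_ (𝐲⊗-zero interiors i j) (correction-y0 i j))))
    GF-bargraphs i j (suc k) =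
      ≡.trans (≡.cong (λ n → ∑ʷ n B i j (suc k)) (twoMore j k))
      (≡.trans (∑ʷ-bargraphs N i j (suc k))
               (≡.cong₂ ℤ._+_ (≡.trans (𝐲⊗-suc (∑ʷ N ⟦ inner ⟧ʷ) i j k) (≡.sym (𝐲⊗-suc interiors i j k)))
                              (correction-coefficient i j k (N ℕ.≟ ℓ))))
      where
      N = j + 2 * k
      twoMore : ∀ j k → j + 2 * suc k ≡ suc (suc (j + 2 * k))
      twoMore = solve-∀ where open import Data.Nat.Tactic.RingSolver

    decomposition : Decomposition ℙ₃ 𝐭 𝐱 𝐲 (𝐱^ ℓ) (P ℓ) interiors
    decomposition = record { bargraphs = trans P≈GF GF-bargraphs ; interiors = interiors-equation }

term-xy : term (+ 1) 0 1 1 ℙ₃.≈ 𝐱 ⊗ 𝐲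
term-xy = ℙ₃.sym (term-⊗ (+ 1) (+ 1) 0 1 0 0 0 1)

term-xwy : ∀ ℓ → term (+ 1) 0 (ℓ + 1) 1 ℙ₃.≈ 𝐱 ⊗ 𝐱^ ℓ ⊗ 𝐲
term-xwy ℓ = ℙ₃.trans (term-exponent (+ 1) 0 1 (≡.trans (ℕ.+-comm ℓ 1) (≡.sym (ℕ.+-identityʳ (suc ℓ)))))
               (ℙ₃.sym (ℙ₃.trans (ℙ₃.*-cong (term-⊗ (+ 1) (+ 1) 0 1 0 0 ℓ 0) (ℙ₃.refl {x = 𝐲}))
                                  (term-⊗ (+ 1) (+ 1) 0 (suc ℓ) 0 0 0 1)))

diagonalDecomposition : ∀ ℓ {S} → Decomposition ℙ₃ 𝐭 𝐱 𝐲 (𝐱^ ℓ) (P ℓ) S → Decomposition ℙ₂ 𝐭₂ 𝐳 𝐳 (𝐳^ ℓ) (Pzz ℓ) (diagonalize S)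
diagonalDecomposition ℓ d = decomposition-cong (diagonalize-term (+ 1) 1 0 0) (diagonalize-term (+ 1) 0 1 0) (diagonalize-term (+ 1) 0 0 1)
  (ℙ₂.trans (diagonalize-term (+ 1) 0 ℓ 0) (𝐳^-cong (ℕ.+-identityʳ ℓ))) (ℙ₂.sym (Pzz≈diagonalizeP ℓ)) ℙ₂.refl
  (decomposition-image diagonalize-isRingHomomorphism d)

linearCoefficient discriminantRoot discriminant : ℕ → PS2
linearCoefficient ℓ = term₂ (+ 1) 0 0 ⊖₂ term₂ (+ 2) 0 1 ⊖₂ term₂ (+ 1) 0 2 ⊕₂ (term₂ (+ 1) 1 0 ⊖₂ term₂ (+ 1) 0 0) ⊗₂ term₂ (+ 1) 0 (ℓ + 2)
discriminantRoot ℓ = linearCoefficient ℓ ⊖₂ term₂ (+ 2) 0 1 ⊗₂ Pzz ℓ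
discriminant ℓ =
  term₂ (+ 1) 0 0 ⊖₂ term₂ (+ 4) 0 1 ⊕₂ term₂ (+ 2) 0 2 ⊕₂ term₂ (+ 1) 0 4
  ⊕₂ term₂ (+ 2) 0 0 ⊗₂ (term₂ (+ 1) 0 0 ⊖₂ term₂ (+ 1) 1 0) ⊗₂ term₂ (+ 1) 0 (ℓ + 2) ⊗₂ (term₂ (+ 1) 0 0 ⊕₂ term₂ (+ 1) 0 2)
  ⊕₂ (term₂ (+ 1) 0 0 ⊖₂ term₂ (+ 1) 1 0) ⊗₂ (term₂ (+ 1) 0 0 ⊖₂ term₂ (+ 1) 1 0) ⊗₂ term₂ (+ 1) 0 (2 * ℓ + 4)

discriminantRoot-constant : ∀ ℓ → discriminantRoot ℓ 0 0 ≡ + 1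
discriminantRoot-constant ℓ rewrite ℕ.+-comm ℓ 2 = refl

discriminantRoot-definition : ∀ ℓ → term₂ (+ 2) 0 1 ⊗₂ Pzz ℓ ℙ₂.≈ linearCoefficient ℓ ⊖₂ discriminantRoot ℓ
discriminantRoot-definition ℓ =
  I₂.solve 2 (λ a x → x I₂.:= a I₂.:- (a I₂.:- x)) ℙ₂.refl (linearCoefficient ℓ) (term₂ (+ 2) 0 1 ⊗₂ Pzz ℓ)
  where module I₂ = IntegerCoefficients ℙ₂

discriminantRoot-square : ∀ ℓ {S} → Decomposition ℙ₂ 𝐭₂ 𝐳 𝐳 (𝐳^ ℓ) (Pzz ℓ) S → discriminantRoot ℓ ⊗₂ discriminantRoot ℓ ℙ₂.≈ discriminant ℓ
discriminantRoot-square ℓ d = BargraphEquations.squareRoot ℙ₂ d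
  {term₂ (+ 1) 0 0} {term₂ (+ 2) 0 0} {term₂ (+ 2) 0 1} {term₂ (+ 4) 0 1} {term₂ (+ 1) 0 2} {term₂ (+ 2) 0 2}
  {term₂ (+ 1) 0 4} {term₂ (+ 1) 0 (ℓ + 2)} {term₂ (+ 1) 0 (2 * ℓ + 4)}
  term₂-one two twoZ fourZ zz twoZZ zzzz zzw zzzzww
  where
  open ℙ₂ hiding (_+_; _*_; refl)
  open import Relation.Binary.Reasoning.Setoid setoid
  twoZ : term₂ (+ 2) 0 1 ℙ₂.≈ 𝐳 ⊕₂ 𝐳
  twoZ = sym (term₂-⊕ (+ 1) (+ 1) 0 1)
  two : term₂ (+ 2) 0 0 ℙ₂.≈ 1# ⊕₂ 1#
  two = trans (sym (term₂-⊕ (+ 1) (+ 1) 0 0)) (+-cong term₂-one term₂-one)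
  fourZ : term₂ (+ 4) 0 1 ℙ₂.≈ 𝐳 ⊕₂ 𝐳 ⊕₂ 𝐳 ⊕₂ 𝐳
  fourZ = sym (trans (+-cong (trans (+-cong (term₂-⊕ (+ 1) (+ 1) 0 1) (ℙ₂.refl {x = 𝐳})) (term₂-⊕ (+ 2) (+ 1) 0 1)) (ℙ₂.refl {x = 𝐳}))
                     (term₂-⊕ (+ 3) (+ 1) 0 1))
  zz : term₂ (+ 1) 0 2 ℙ₂.≈ 𝐳 ⊗₂ 𝐳
  zz = sym (𝐳^-+ 1 1)
  twoZZ : term₂ (+ 2) 0 2 ℙ₂.≈ 𝐳 ⊗₂ 𝐳 ⊕₂ 𝐳 ⊗₂ 𝐳
  twoZZ = trans (sym (term₂-⊕ (+ 1) (+ 1) 0 2)) (+-cong zz zz)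
  zzzz : term₂ (+ 1) 0 4 ℙ₂.≈ 𝐳 ⊗₂ 𝐳 ⊗₂ 𝐳 ⊗₂ 𝐳
  zzzz = sym (trans (*-cong (trans (*-cong (𝐳^-+ 1 1) (ℙ₂.refl {x = 𝐳})) (𝐳^-+ 2 1)) (ℙ₂.refl {x = 𝐳})) (𝐳^-+ 3 1))
  zzw : term₂ (+ 1) 0 (ℓ + 2) ℙ₂.≈ 𝐳 ⊗₂ 𝐳 ⊗₂ 𝐳^ ℓ
  zzw = sym (trans (*-cong (𝐳^-+ 1 1) (ℙ₂.refl {x = 𝐳^ ℓ})) (trans (𝐳^-+ 2 ℓ) (𝐳^-cong (ℕ.+-comm 2 ℓ))))
  zzzzww : term₂ (+ 1) 0 (2 * ℓ + 4) ℙ₂.≈ 𝐳 ⊗₂ 𝐳 ⊗₂ 𝐳 ⊗₂ 𝐳 ⊗₂ 𝐳^ ℓ ⊗₂ 𝐳^ ℓ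
  zzzzww = sym (begin
    𝐳 ⊗₂ 𝐳 ⊗₂ 𝐳 ⊗₂ 𝐳 ⊗₂ 𝐳^ ℓ ⊗₂ 𝐳^ ℓ ≈⟨ *-cong (*-cong zzzz (ℙ₂.refl {x = 𝐳^ ℓ})) (ℙ₂.refl {x = 𝐳^ ℓ}) ⟨
    𝐳^ 4 ⊗₂ 𝐳^ ℓ ⊗₂ 𝐳^ ℓ             ≈⟨ trans (*-cong (𝐳^-+ 4 ℓ) (ℙ₂.refl {x = 𝐳^ ℓ})) (𝐳^-+ (4 + ℓ) ℓ) ⟩
    𝐳^ (4 + ℓ + ℓ)                   ≈⟨ 𝐳^-cong (regroup ℓ) ⟩
    𝐳^ (2 * ℓ + 4)                   ∎)
    where
    regroup : ∀ ℓ → 4 + ℓ + ℓ ≡ 2 * ℓ + 4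
    regroup = solve-∀ where open import Data.Nat.Tactic.RingSolver

mainTheorem5 : (ℓ : ℕ) → 1 ≤ ℓ →
  (∀ i j k →
    ( term (+ 1) 0 1 0 ⊗ P ℓ ⊗ P ℓ
    ⊖ ( term (+ 1) 0 0 0 ⊖ term (+ 1) 0 1 0 ⊖ term (+ 1) 0 0 1 ⊖ term (+ 1) 0 1 1
      ⊖ (term (+ 1) 0 0 0 ⊖ term (+ 1) 1 0 0) ⊗ term (+ 1) 0 (ℓ + 1) 1 ) ⊗ P ℓ
    ⊕ term (+ 1) 0 0 1 ⊗ ( term (+ 1) 0 1 0
      ⊖ (term (+ 1) 0 0 0 ⊖ term (+ 1) 1 0 0) ⊗ (term (+ 1) 0 0 0 ⊖ term (+ 1) 0 1 0)
        ⊗ term (+ 1) 0 ℓ 0 ) ) i j k ≡ + 0)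
  ×
  Σ PS2 (λ S →
    (S 0 0 ≡ + 1)
    × (∀ i n → (S ⊗₂ S) i n ≡
        ( term₂ (+ 1) 0 0 ⊖₂ term₂ (+ 4) 0 1 ⊕₂ term₂ (+ 2) 0 2 ⊕₂ term₂ (+ 1) 0 4
        ⊕₂ term₂ (+ 2) 0 0 ⊗₂ (term₂ (+ 1) 0 0 ⊖₂ term₂ (+ 1) 1 0) ⊗₂ term₂ (+ 1) 0 (ℓ + 2)
           ⊗₂ (term₂ (+ 1) 0 0 ⊕₂ term₂ (+ 1) 0 2)
        ⊕₂ (term₂ (+ 1) 0 0 ⊖₂ term₂ (+ 1) 1 0) ⊗₂ (term₂ (+ 1) 0 0 ⊖₂ term₂ (+ 1) 1 0)
           ⊗₂ term₂ (+ 1) 0 (2 * ℓ + 4) ) i n)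
    × (∀ i n → (term₂ (+ 2) 0 1 ⊗₂ Pzz ℓ) i n ≡
        ( term₂ (+ 1) 0 0 ⊖₂ term₂ (+ 2) 0 1 ⊖₂ term₂ (+ 1) 0 2
        ⊕₂ (term₂ (+ 1) 1 0 ⊖₂ term₂ (+ 1) 0 0) ⊗₂ term₂ (+ 1) 0 (ℓ + 2)
        ⊖₂ S ) i n))
mainTheorem5 ℓ 1≤ℓ =
    BargraphEquations.functionalEquation-monomials ℙ₃ decomposition₃
      {term (+ 1) 0 0 0} {term (+ 1) 0 1 1} {term (+ 1) 0 (ℓ + 1) 1} term-one term-xy (term-xwy ℓ)
  , ( discriminantRoot ℓ
    , discriminantRoot-constant ℓ
    , discriminantRoot-square ℓ (diagonalDecomposition ℓ decomposition₃)
    , discriminantRoot-definition ℓ )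
  where
  decomposition₃ : Decomposition ℙ₃ 𝐭 𝐱 𝐲 (𝐱^ ℓ) (P ℓ) (BargraphSeries.interiors ℓ)
  decomposition₃ = BargraphSeries.decomposition ℓ 1≤ℓ
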